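{- Let $\mathcal{C}$ be a class of functions with co-domain $\{0,1\}$, and let $C$ be a $\mathsf{SUM}\circ\mathcal{C}$ circuit of sparsity $s$ that is Boolean-valued. Then there is an equivalent $\mathsf{SUM}\circ\mathcal{C}$ circuit $C'$ (computing the same function on $\{0,1\}^n$) such that every weight in the linear combination of $C'$ has the form $j/k$ where $j$ and $k$ are integers in $[-s^{s/2},s^{s/2}]$.
   Context: A $\mathsf{SUM}\circ\mathcal{C}$ circuit on $n$ inputs is an $\mathbb{R}$-linear combination $\sum_{i=1}^s\alpha_ic_i$ of functions $c_i\in\mathcal{C}$, of sparsity $s$, with weights $\alpha_i$. It is Boolean-valued if its value on every $x\in\{0,1\}^n$ is in $\{0,1\}$. -}

module Defs where

open import Level using (Level; _⊔_) renaming (suc to lsuc)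
open import Data.Bool using (Bool; true; false)
open import Data.Nat using (ℕ; zero; suc)
open import Data.Integer using (ℤ; +_; -[1+_])
open import Data.Fin using (Fin; zero; suc)
open import Data.Vec using (Vec)
open import Data.Product using (Σ; ∃; _×_)
open import Relation.Nullary using (¬_)
open import Algebra.Bundles using (CommutativeRing)

-- A field of characteristic zero (the reals ℝ are the intended instance;
-- the stdlib has no reals).  Equality is the setoid equality ≈.
-- canonical image of ℕ in a commutative ring
ringFromℕ : ∀ {c ℓ} (R : CommutativeRing c ℓ) → ℕ → CommutativeRing.Carrier R
ringFromℕ R zero    = CommutativeRing.0# R
ringFromℕ R (suc n) = CommutativeRing._+_ R (CommutativeRing.1# R) (ringFromℕ R n)

record CharZeroField c ℓ : Set (lsuc (c ⊔ ℓ)) where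
  field
    ring : CommutativeRing c ℓ
    1≉0     : ¬ (CommutativeRing._≈_ ring (CommutativeRing.1# ring) (CommutativeRing.0# ring))
    inverse : ∀ x → ¬ (CommutativeRing._≈_ ring x (CommutativeRing.0# ring)) →
              ∃ λ y → CommutativeRing._≈_ ring (CommutativeRing._*_ ring x y) (CommutativeRing.1# ring)
    charZero : ∀ n → ¬ (CommutativeRing._≈_ ring (ringFromℕ ring (suc n)) (CommutativeRing.0# ring))
  open CommutativeRing ring public hiding (ring)
  fromℕ : ℕ → Carrier
  fromℕ = ringFromℕ ring

module _ {c ℓ} (F : CharZeroField c ℓ) where
  open CharZeroField F using (Carrier; _≈_; _+_; _*_; -_; 0#; 1#; fromℕ)

  fromℤ : ℤ → Carrier
  fromℤ (+ n)     = fromℕ n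
  fromℤ -[1+ n ]  = - fromℕ (suc n)

  bit : Bool → Carrier
  bit true  = 1#
  bit false = 0#

  sumF : (s : ℕ) → (Fin s → Carrier) → Carrier
  sumF zero    f = 0#
  sumF (suc s) f = f zero + sumF s (λ i → f (suc i))

  evalSum : ∀ {n} (s : ℕ) → (Fin s → Carrier) → (Fin s → Vec Bool n → Bool)
          → Vec Bool n → Carrier
  evalSum s α c x = sumF s (λ i → α i * bit (c i x))

  BooleanValued : ∀ {n} (s : ℕ) → (Fin s → Carrier) → (Fin s → Vec Bool n → Bool) → Set ℓ
  BooleanValued {n} s α c = ∀ (x : Vec Bool n) →
    Data.Sum._⊎_ (evalSum s α c x ≈ 0#) (evalSum s α c x ≈ 1#)
    where import Data.Sum

module Submission where

-- Choose a maximal nonsingular square submatrix A (r functions,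
-- r points) of the 0/1 evaluation matrix of c₁ … c_s; r ≤ s.  Bordering A by
-- any further point and the row of circuit outputs f gives a singular
-- matrix, because that row is the α-combination of function rows and all
-- function-bordered minors are singular by maximality.  Cramer's rule then
-- writes f as Σⱼ (wⱼ / det A) c_{S j} with wⱼ, det A determinants of r × r
-- 0/1 matrices, and Hadamard's inequality bounds their squares by rʳ ≤ sˢ.

open import Algebra.Bundles using (CommutativeRing)
open import Data.Nat using (ℕ)
open import Data.Bool using (Bool)
open import Data.Vec using (Vec)
open import Data.Fin using (Fin)
open import Defs

-- It lets us compute determinants over ℤ (where they can be bounded) and
-- transport the results to the field, and it powers the ring solver with
-- integer coefficients used for routine algebra below.
module IntegerImage {c ℓ} (R : CommutativeRing c ℓ) where

  open import Data.Nat as ℕ using (ℕ; zero; suc)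
  open import Data.Integer as ℤ using (ℤ; +_; -[1+_]; _⊖_; _◃_)
  import Data.Nat.Properties as ℕP
  import Data.Integer.Properties as ℤP
  open import Data.Sign as Sign using (Sign)
  open import Data.Maybe using (Maybe; just; nothing)
  open import Relation.Nullary using (yes; no)
  open import Relation.Binary.PropositionalEquality as ≡ using (_≡_)
  open import Algebra.Solver.Ring.AlmostCommutativeRing
    using (fromCommutativeRing; _-Raw-AlmostCommutative⟶_)
  import Algebra.Solver.Ring as RingSolver
  open CommutativeRing R
  open import Algebra.Properties.Semiring.Mult semiring using (_×_; ×-homo-+; ×1-homo-*)
  open import Algebra.Properties.Ring ring using (-‿involutive; -‿+-comm; -0#≈0#; -1*x≈-x)
  open import Algebra.Properties.CommutativeSemigroup *-commutativeSemigroup using (interchange)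
  open import Relation.Binary.Reasoning.Setoid setoid

  natᴿ : ℕ → Carrier
  natᴿ = ringFromℕ R

  intᴿ : ℤ → Carrier
  intᴿ (+ n)    = natᴿ n
  intᴿ -[1+ n ] = - natᴿ (suc n)

  natᴿ≈× : ∀ n → natᴿ n ≈ n × 1#
  natᴿ≈× zero    = refl
  natᴿ≈× (suc n) = +-congˡ (natᴿ≈× n)

  natᴿ-+ : ∀ m n → natᴿ (m ℕ.+ n) ≈ natᴿ m + natᴿ n
  natᴿ-+ m n = begin
    natᴿ (m ℕ.+ n)     ≈⟨ natᴿ≈× (m ℕ.+ n) ⟩
    (m ℕ.+ n) × 1#     ≈⟨ ×-homo-+ 1# m n ⟩
    m × 1# + n × 1#    ≈⟨ +-cong (natᴿ≈× m) (natᴿ≈× n) ⟨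
    natᴿ m + natᴿ n    ∎

  natᴿ-* : ∀ m n → natᴿ (m ℕ.* n) ≈ natᴿ m * natᴿ n
  natᴿ-* m n = begin
    natᴿ (m ℕ.* n)     ≈⟨ natᴿ≈× (m ℕ.* n) ⟩
    (m ℕ.* n) × 1#     ≈⟨ ×1-homo-* m n ⟩
    m × 1# * n × 1#    ≈⟨ *-cong (natᴿ≈× m) (natᴿ≈× n) ⟨
    natᴿ m * natᴿ n    ∎

  cancel-1 : ∀ x y → (1# + x) + - (1# + y) ≈ x + - y
  cancel-1 x y = begin
    (1# + x) + - (1# + y)    ≈⟨ +-congˡ (-‿+-comm 1# y) ⟨
    (1# + x) + (- 1# + - y)  ≈⟨ +-congʳ (+-comm 1# x) ⟩
    (x + 1#) + (- 1# + - y)  ≈⟨ +-assoc x 1# _ ⟩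
    x + (1# + (- 1# + - y))  ≈⟨ +-congˡ (+-assoc 1# (- 1#) (- y)) ⟨
    x + ((1# + - 1#) + - y)  ≈⟨ +-congˡ (+-congʳ (-‿inverseʳ 1#)) ⟩
    x + (0# + - y)           ≈⟨ +-congˡ (+-identityˡ (- y)) ⟩
    x + - y                  ∎

  intᴿ-⊖ : ∀ m n → intᴿ (m ⊖ n) ≈ natᴿ m + - natᴿ n
  intᴿ-⊖ m       zero    = trans (sym (+-identityʳ _)) (+-congˡ (sym -0#≈0#))
  intᴿ-⊖ zero    (suc n) = sym (+-identityˡ _)
  intᴿ-⊖ (suc m) (suc n) = begin
    intᴿ (suc m ⊖ suc n)          ≡⟨ ≡.cong intᴿ (ℤP.[1+m]⊖[1+n]≡m⊖n m n) ⟩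
    intᴿ (m ⊖ n)                  ≈⟨ intᴿ-⊖ m n ⟩
    natᴿ m + - natᴿ n             ≈⟨ cancel-1 _ _ ⟨
    natᴿ (suc m) + - natᴿ (suc n) ∎

  intᴿ-+ : ∀ i j → intᴿ (i ℤ.+ j) ≈ intᴿ i + intᴿ j
  intᴿ-+ (+ m)    (+ n)    = natᴿ-+ m n
  intᴿ-+ (+ m)    -[1+ n ] = intᴿ-⊖ m (suc n)
  intᴿ-+ -[1+ m ] (+ n)    = trans (intᴿ-⊖ n (suc m)) (+-comm _ _)
  intᴿ-+ -[1+ m ] -[1+ n ] = begin
    - natᴿ (suc (suc (m ℕ.+ n)))           ≡⟨ ≡.cong (λ k → - natᴿ (suc k)) (ℕP.+-suc m n) ⟨
    - natᴿ (suc m ℕ.+ suc n)               ≈⟨ -‿cong (natᴿ-+ (suc m) (suc n)) ⟩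
    - (natᴿ (suc m) + natᴿ (suc n))        ≈⟨ -‿+-comm _ _ ⟨
    - natᴿ (suc m) + - natᴿ (suc n)        ∎

  intᴿ-neg : ∀ i → intᴿ (ℤ.- i) ≈ - intᴿ i
  intᴿ-neg (+ zero)  = sym -0#≈0#
  intᴿ-neg (+ suc n) = refl
  intᴿ-neg -[1+ n ]  = sym (-‿involutive _)

  -- Multiplicativity goes through the sign–magnitude decomposition of ℤ.
  signᴿ : Sign → Carrier
  signᴿ Sign.+ = 1#
  signᴿ Sign.- = - 1#

  signᴿ-* : ∀ s t → signᴿ (s Sign.* t) ≈ signᴿ s * signᴿ t
  signᴿ-* Sign.- Sign.- = sym (trans (-1*x≈-x (- 1#)) (-‿involutive 1#))
  signᴿ-* Sign.- Sign.+ = sym (*-identityʳ _)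
  signᴿ-* Sign.+ Sign.- = sym (*-identityˡ _)
  signᴿ-* Sign.+ Sign.+ = sym (*-identityˡ _)

  intᴿ-◃ : ∀ s n → intᴿ (s ◃ n) ≈ signᴿ s * natᴿ n
  intᴿ-◃ s      zero    = sym (zeroʳ _)
  intᴿ-◃ Sign.- (suc n) = sym (-1*x≈-x _)
  intᴿ-◃ Sign.+ (suc n) = sym (*-identityˡ _)

  intᴿ-sign-abs : ∀ i → intᴿ i ≈ signᴿ (ℤ.sign i) * natᴿ ℤ.∣ i ∣
  intᴿ-sign-abs (+ zero)  = sym (zeroʳ _)
  intᴿ-sign-abs (+ suc n) = sym (*-identityˡ _)
  intᴿ-sign-abs -[1+ n ]  = sym (-1*x≈-x _)

  intᴿ-* : ∀ i j → intᴿ (i ℤ.* j) ≈ intᴿ i * intᴿ j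
  intᴿ-* i j = begin
    intᴿ (si Sign.* sj ◃ ai ℕ.* aj)                     ≈⟨ intᴿ-◃ (si Sign.* sj) (ai ℕ.* aj) ⟩
    signᴿ (si Sign.* sj) * natᴿ (ai ℕ.* aj)             ≈⟨ *-cong (signᴿ-* si sj) (natᴿ-* ai aj) ⟩
    (signᴿ si * signᴿ sj) * (natᴿ ai * natᴿ aj)         ≈⟨ interchange _ _ _ _ ⟩
    (signᴿ si * natᴿ ai) * (signᴿ sj * natᴿ aj)         ≈⟨ *-cong (intᴿ-sign-abs i) (intᴿ-sign-abs j) ⟨
    intᴿ i * intᴿ j                                     ∎
    where
    si = ℤ.sign i
    sj = ℤ.sign j
    ai = ℤ.∣ i ∣
    aj = ℤ.∣ j ∣

  module Solver where
    ℤ-homomorphism : CommutativeRing.rawRing ℤP.+-*-commutativeRing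
                       -Raw-AlmostCommutative⟶ fromCommutativeRing R
    ℤ-homomorphism = record
      { ⟦_⟧ = intᴿ ; +-homo = intᴿ-+ ; *-homo = intᴿ-* ; -‿homo = intᴿ-neg
      ; 0-homo = refl ; 1-homo = +-identityʳ 1# }

    -- only syntactic coefficient equality is needed for normalisation
    coefficient-equal? : ∀ (i j : ℤ) → Maybe (intᴿ i ≈ intᴿ j)
    coefficient-equal? i j with i ℤ.≟ j
    ... | yes ≡.refl = just refl
    ... | no _       = nothing

    open RingSolver _ _ ℤ-homomorphism coefficient-equal? public

-- The central fact is the uniqueness of alternating
-- multilinear forms (every such D satisfies D M = det M · D 1), from which
-- the product formula and invariance under transposition follow.
module Determinant {c ℓ} (R : CommutativeRing c ℓ) where

  open import Level using (_⊔_)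
  open import Data.Nat as ℕ using (ℕ; zero; suc)
  import Data.Nat.Properties as ℕP
  open import Data.Fin as Fin using (Fin; zero; suc; punchIn; punchOut; inject₁; toℕ)
  import Data.Fin.Properties as FinP
  open import Data.Fin.Properties using (punchIn-injective; punchInᵢ≢i; punchIn-punchOut; suc-injective)
  open import Data.Vec.Functional using (updateAt; insertAt)
  open import Data.Vec.Functional.Properties using (updateAt-updates; updateAt-minimal; insertAt-lookup; insertAt-punchIn)
  open import Data.Empty using (⊥-elim)
  open import Relation.Nullary using (yes; no)
  open import Relation.Binary.PropositionalEquality as ≡ using (_≡_; _≢_)
  open import Function using (_∘_)

  open CommutativeRing R hiding (zero)
  open import Relation.Binary.Reasoning.Setoid setoid
  open import Algebra.Properties.Semiring.Sum semiring public using (sum)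
  open import Algebra.Properties.Semiring.Sum semiring
    using (sum-cong-≋; sum-remove; sum-replicate-zero; ∑-distrib-+; ∑-comm; *-distribˡ-sum; *-distribʳ-sum)
  open import Algebra.Properties.Ring ring using (-‿injective; -0#≈0#; -‿distribˡ-*; +-inverseʳ-unique; x+x≈x⇒x≈0)
  open IntegerImage R using (module Solver)
  open Solver using (solve; _:+_; _:*_; :-_; _:=_)

  sum-cong : ∀ {n} {f g : Fin n → Carrier} → (∀ i → f i ≈ g i) → sum f ≈ sum g
  sum-cong = sum-cong-≋

  sum-zero : ∀ {n} (f : Fin n → Carrier) → (∀ i → f i ≈ 0#) → sum f ≈ 0#
  sum-zero {n} f f≈0 = trans (sum-cong f≈0) (sum-replicate-zero n)

  sum-single : ∀ {n} (f : Fin n → Carrier) k → (∀ i → i ≢ k → f i ≈ 0#) → sum f ≈ f k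
  sum-single {suc n} f k others = begin
    sum f                                  ≈⟨ sum-remove {i = k} f ⟩
    f k + sum (λ i → f (punchIn k i))       ≈⟨ +-congˡ (sum-zero _ (λ i → others _ (punchInᵢ≢i k i))) ⟩
    f k + 0#                               ≈⟨ +-identityʳ _ ⟩
    f k                                    ∎

  sum-lin : ∀ {n} a (f g : Fin n → Carrier) → sum (λ i → a * f i + g i) ≈ a * sum f + sum g
  sum-lin a f g = trans (∑-distrib-+ (λ i → a * f i) g) (+-congʳ (sym (*-distribˡ-sum a f)))

  -- Matrices as functions; rows are the first index.

  Mat : ℕ → ℕ → Set c
  Mat m n = Fin m → Fin n → Carrier

  SMat : ℕ → Set c
  SMat n = Mat n n

  infix 4 _≋_
  _≋_ : ∀ {m n} → Mat m n → Mat m n → Set ℓ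
  M ≋ N = ∀ i j → M i j ≈ N i j

  sgn : ∀ {n} → Fin n → Carrier
  sgn zero    = 1#
  sgn (suc i) = - sgn i

  minor : ∀ {m n} → Fin (suc m) → Fin (suc n) → Mat (suc m) (suc n) → Mat m n
  minor i j M a b = M (punchIn i a) (punchIn j b)

  det : ∀ {n} → SMat n → Carrier
  det {zero}  M = 1#
  det {suc n} M = sum (λ i → sgn i * (M i zero * det (minor i zero M)))

  det′ : ∀ {n} → SMat n → Carrier
  det′ {zero}  M = 1#
  det′ {suc n} M = sum (λ j → sgn j * (M zero j * det′ (minor zero j M)))

  det-cong : ∀ {n} {M N : SMat n} → M ≋ N → det M ≈ det N
  det-cong {zero}  M≋N = refl
  det-cong {suc n} M≋N =
    sum-cong (λ i → *-congˡ {sgn i} (*-cong (M≋N i zero) (det-cong (λ a b → M≋N (punchIn i a) (suc b)))))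

  setRow : ∀ {m n} → Mat m n → Fin m → (Fin n → Carrier) → Mat m n
  setRow M k u = updateAt M k (λ _ → u)

  setRow-≡ : ∀ {m n} (M : Mat m n) k u j → setRow M k u k j ≈ u j
  setRow-≡ M k u j = reflexive (≡.cong (λ row → row j) (updateAt-updates k M))

  setRow-≢ : ∀ {m n} (M : Mat m n) k u {i} → i ≢ k → ∀ j → setRow M k u i j ≈ M i j
  setRow-≢ M k u {i} i≢k j = reflexive (≡.cong (λ row → row j) (updateAt-minimal i k M i≢k))

  Respects≋ : ∀ {n} → (SMat n → Carrier) → Set (c ⊔ ℓ)
  Respects≋ D = ∀ {M N} → M ≋ N → D M ≈ D N

  RowLinear : ∀ {n} → (SMat n → Carrier) → Set (c ⊔ ℓ)
  RowLinear {n} D = ∀ (k : Fin n) (a : Carrier) (X Y Z : SMat n) →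
    (∀ i → i ≢ k → ∀ j → X i j ≈ Z i j) → (∀ i → i ≢ k → ∀ j → Y i j ≈ Z i j) →
    (∀ j → Z k j ≈ a * X k j + Y k j) → D Z ≈ a * D X + D Y

  AlternatingAt : ∀ {n} → (SMat n → Carrier) → Fin n → Fin n → Set (c ⊔ ℓ)
  AlternatingAt D p q = ∀ N → (∀ j → N p j ≈ N q j) → D N ≈ 0#

  Alternating : ∀ {n} → (SMat n → Carrier) → Set (c ⊔ ℓ)
  Alternating {n} D = ∀ p q → p ≢ q → AlternatingAt D p q

  module TwoRowReplacement {n} {p q : Fin n} (p≢q : p ≢ q) (M : SMat n) where

    W : (Fin n → Carrier) → (Fin n → Carrier) → SMat n
    W x y = setRow (setRow M p x) q y

    W-p : ∀ x y j → W x y p j ≈ x j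
    W-p x y j = trans (setRow-≢ _ q y p≢q j) (setRow-≡ M p x j)

    W-q : ∀ x y j → W x y q j ≈ y j
    W-q x y j = setRow-≡ _ q y j

    W-others : ∀ x y {i} → i ≢ p → i ≢ q → ∀ j → W x y i j ≈ M i j
    W-others x y i≢p i≢q j = trans (setRow-≢ _ q y i≢q j) (setRow-≢ M p x i≢p j)

    W-char : ∀ N {x y} → (∀ j → N p j ≈ x j) → (∀ j → N q j ≈ y j) →
             (∀ i → i ≢ p → i ≢ q → ∀ j → N i j ≈ M i j) → N ≋ W x y
    W-char N {x} {y} Np Nq No i j with i Fin.≟ p | i Fin.≟ q
    ... | yes ≡.refl | _          = trans (Np j) (sym (W-p x y j))
    ... | no _       | yes ≡.refl = trans (Nq j) (sym (W-q x y j))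
    ... | no i≢p     | no i≢q     = trans (No i i≢p i≢q j) (sym (W-others x y i≢p i≢q j))

    W-off-p : ∀ x x′ y i → i ≢ p → ∀ j → W x y i j ≈ W x′ y i j
    W-off-p x x′ y i i≢p j with i Fin.≟ q
    ... | yes ≡.refl = trans (W-q x y j) (sym (W-q x′ y j))
    ... | no i≢q     = trans (W-others x y i≢p i≢q j) (sym (W-others x′ y i≢p i≢q j))

    W-off-q : ∀ x y y′ i → i ≢ q → ∀ j → W x y i j ≈ W x y′ i j
    W-off-q x y y′ i i≢q j = trans (setRow-≢ _ q y i≢q j) (sym (setRow-≢ _ q y′ i≢q j))

  module RowLinearForm {n} (D : SMat n → Carrier) (D-cong : Respects≋ D) (D-lin : RowLinear D) where

    D-add : ∀ k (X Y Z : SMat n) →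
      (∀ i → i ≢ k → ∀ j → X i j ≈ Z i j) → (∀ i → i ≢ k → ∀ j → Y i j ≈ Z i j) →
      (∀ j → Z k j ≈ X k j + Y k j) → D Z ≈ D X + D Y
    D-add k X Y Z X≈Z Y≈Z Zk =
      trans (D-lin k 1# X Y Z X≈Z Y≈Z (λ j → trans (Zk j) (+-congʳ (sym (*-identityˡ _)))))
            (+-congʳ (*-identityˡ _))

    -- a zero row forces D to vanish (since D Z = D Z + D Z)
    D-zero : ∀ k (Z : SMat n) → (∀ j → Z k j ≈ 0#) → D Z ≈ 0#
    D-zero k Z Zk≈0 = x+x≈x⇒x≈0 (D Z) (sym (D-add k Z Z Z (λ _ _ _ → refl) (λ _ _ _ → refl)
      (λ j → trans (Zk≈0 j) (sym (trans (+-cong (Zk≈0 j) (Zk≈0 j)) (+-identityʳ 0#))))))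

    D-expand : ∀ k {m} (a : Fin m → Carrier) (u : Fin m → Fin n → Carrier) (Z : SMat n) →
      (∀ j → Z k j ≈ sum (λ l → a l * u l j)) → D Z ≈ sum (λ l → a l * D (setRow Z k (u l)))
    D-expand k {zero}  a u Z Zk = D-zero k Z Zk
    D-expand k {suc m} a u Z Zk = begin
      D Z                        ≈⟨ D-lin k (a zero) X Y Z (λ i i≢k j → setRow-≢ Z k _ i≢k j)
                                      (λ i i≢k j → setRow-≢ Z k _ i≢k j) row-k ⟩
      a zero * D X + D Y          ≈⟨ +-congˡ (D-expand k (a ∘ suc) (u ∘ suc) Y (setRow-≡ Z k _)) ⟩
      a zero * D X + sum (λ l → a (suc l) * D (setRow Y k (u (suc l))))
                                  ≈⟨ +-congˡ (sum-cong (λ l → *-congˡ (D-cong (setRow-twice l)))) ⟩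
      sum (λ l → a l * D (setRow Z k (u l))) ∎
      where
      X = setRow Z k (u zero)
      Y = setRow Z k (λ j → sum (λ l → a (suc l) * u (suc l) j))
      row-k : ∀ j → Z k j ≈ a zero * X k j + Y k j
      row-k j = trans (Zk j) (sym (+-cong (*-congˡ (setRow-≡ Z k _ j)) (setRow-≡ Z k _ j)))
      setRow-twice : ∀ l → setRow Y k (u (suc l)) ≋ setRow Z k (u (suc l))
      setRow-twice l i j with i Fin.≟ k
      ... | yes ≡.refl = trans (setRow-≡ Y k _ j) (sym (setRow-≡ Z k _ j))
      ... | no i≢k     = trans (setRow-≢ Y k _ i≢k j)
                           (trans (setRow-≢ Z k _ i≢k j) (sym (setRow-≢ Z k _ i≢k j)))

    -- If D vanishes when rows p and q agree, exchanging rows p and q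
    -- changes the sign of D: expand D (W (u+v) (u+v)) = 0 in both rows.
    -- M′ is any matrix obtained from M by the exchange.
    D-exchange : ∀ p q → p ≢ q → AlternatingAt D p q → ∀ M M′ →
      (∀ j → M′ p j ≈ M q j) → (∀ j → M′ q j ≈ M p j) →
      (∀ i → i ≢ p → i ≢ q → ∀ j → M′ i j ≈ M i j) → D M′ ≈ - D M
    D-exchange p q p≢q alt M M′ M′p M′q M′o = begin
      D M′             ≈⟨ D-cong (W-char M′ M′p M′q M′o) ⟩
      D (W v u)        ≈⟨ +-inverseʳ-unique _ _ expansion ⟩
      - D (W u v)      ≈⟨ -‿cong (D-cong (W-char M (λ _ → refl) (λ _ → refl) (λ _ _ _ _ → refl))) ⟨
      - D M            ∎
      where
      open TwoRowReplacement p≢q M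
      u = M p
      v = M q
      u+v = λ j → u j + v j
      add-p : ∀ x x′ y → D (W (λ j → x j + x′ j) y) ≈ D (W x y) + D (W x′ y)
      add-p x x′ y = D-add p _ _ _ (λ i i≢p → W-off-p _ _ y i i≢p) (λ i i≢p → W-off-p _ _ y i i≢p)
        (λ j → trans (W-p _ y j) (sym (+-cong (W-p x y j) (W-p x′ y j))))
      add-q : ∀ x y y′ → D (W x (λ j → y j + y′ j)) ≈ D (W x y) + D (W x y′)
      add-q x y y′ = D-add q _ _ _ (λ i i≢q → W-off-q x _ _ i i≢q) (λ i i≢q → W-off-q x _ _ i i≢q)
        (λ j → trans (W-q x _ j) (sym (+-cong (W-q x y j) (W-q x y′ j))))
      equal-rows : ∀ x → D (W x x) ≈ 0#
      equal-rows x = alt (W x x) (λ j → trans (W-p x x j) (sym (W-q x x j)))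
      expansion : D (W u v) + D (W v u) ≈ 0#
      expansion = begin
        D (W u v) + D (W v u)                               ≈⟨ +-cong (+-identityˡ _) (+-identityʳ _) ⟨
        (0# + D (W u v)) + (D (W v u) + 0#)                 ≈⟨ +-cong (+-congʳ (equal-rows u)) (+-congˡ (equal-rows v)) ⟨
        (D (W u u) + D (W u v)) + (D (W v u) + D (W v v))   ≈⟨ +-cong (add-q u u v) (add-q v u v) ⟨
        D (W u u+v) + D (W v u+v)                           ≈⟨ add-p u v u+v ⟨
        D (W u+v u+v)                                       ≈⟨ equal-rows u+v ⟩
        0#                                                  ∎

  -- If D vanishes on equal rows 0 and q for every q, it is alternating:
  -- rows p, q ≠ 0 are reduced to that case by exchanging rows 0 and p.
  alternating-from-row0 : ∀ {m} (D : SMat (suc m) → Carrier) → Respects≋ D → RowLinear D →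
    (∀ q → AlternatingAt D zero (suc q)) → Alternating D
  alternating-from-row0 D D-cong D-lin alt0 zero    zero    0≢0 = ⊥-elim (0≢0 ≡.refl)
  alternating-from-row0 D D-cong D-lin alt0 zero    (suc q) _   = alt0 q
  alternating-from-row0 D D-cong D-lin alt0 (suc p) zero    _   N Np≈N0 = alt0 p N (λ j → sym (Np≈N0 j))
  alternating-from-row0 D D-cong D-lin alt0 (suc p) (suc q) p≢q M Mp≈Mq =
    -‿injective (trans (sym D-swapped) (trans (alt0 q M′ row0≈rowq) (sym -0#≈0#)))
    where
    open RowLinearForm D D-cong D-lin using (D-exchange)
    M′ = setRow (setRow M zero (M (suc p))) (suc p) (M zero)
    keep-0 : ∀ {i} → i ≢ zero → ∀ j → setRow M zero (M (suc p)) i j ≈ M i j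
    keep-0 i≢0 = setRow-≢ M zero (M (suc p)) i≢0
    row0 : ∀ j → M′ zero j ≈ M (suc p) j
    row0 j = trans (setRow-≢ (setRow M zero (M (suc p))) (suc p) (M zero) {zero} (λ ()) j) (setRow-≡ M zero (M (suc p)) j)
    rowp : ∀ j → M′ (suc p) j ≈ M zero j
    rowp = setRow-≡ (setRow M zero (M (suc p))) (suc p) (M zero)
    others : ∀ i → i ≢ zero → i ≢ suc p → ∀ j → M′ i j ≈ M i j
    others i i≢0 i≢p j = trans (setRow-≢ (setRow M zero (M (suc p))) (suc p) (M zero) i≢p j) (keep-0 i≢0 j)
    D-swapped : D M′ ≈ - D M
    D-swapped = D-exchange zero (suc p) (λ ()) (alt0 p) M M′ row0 rowp others
    row0≈rowq : ∀ j → M′ zero j ≈ M′ (suc q) j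
    row0≈rowq j = trans (row0 j) (trans (Mp≈Mq j)
      (sym (others (suc q) (λ ()) (p≢q ∘ ≡.sym) j)))

  pull : ∀ {m n} → Fin (suc m) → Mat (suc m) n → Mat (suc m) n
  pull j N zero    = N j
  pull j N (suc a) = N (punchIn j a)

  -- index bookkeeping relating pull (suc j) and pull (inject₁ j)
  punchIn-inject₁-self : ∀ {m} (j : Fin m) → punchIn (inject₁ j) j ≡ suc j
  punchIn-inject₁-self zero    = ≡.refl
  punchIn-inject₁-self (suc j) = ≡.cong suc (punchIn-inject₁-self j)

  punchIn-suc-self : ∀ {m} (j : Fin m) → punchIn (suc j) j ≡ inject₁ j
  punchIn-suc-self zero    = ≡.refl
  punchIn-suc-self (suc j) = ≡.cong suc (punchIn-suc-self j)

  punchIn-inject₁-suc : ∀ {m} (j a : Fin m) → a ≢ j → punchIn (inject₁ j) a ≡ punchIn (suc j) a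
  punchIn-inject₁-suc zero    zero    a≢j = ⊥-elim (a≢j ≡.refl)
  punchIn-inject₁-suc zero    (suc a) _   = ≡.refl
  punchIn-inject₁-suc (suc j) zero    _   = ≡.refl
  punchIn-inject₁-suc (suc j) (suc a) a≢j = ≡.cong suc (punchIn-inject₁-suc j a (a≢j ∘ ≡.cong suc))

  sgn² : ∀ {m} (j : Fin m) → sgn j * sgn j ≈ 1#
  sgn² zero    = *-identityˡ 1#
  sgn² (suc j) = trans (solve 1 (λ s → (:- s) :* (:- s) := s :* s) refl (sgn j)) (sgn² j)

  sgn-inject₁ : ∀ {m} (j : Fin m) → sgn (inject₁ j) ≡ sgn j
  sgn-inject₁ zero    = ≡.refl
  sgn-inject₁ (suc j) = ≡.cong -_ (sgn-inject₁ j)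

  module AlternatingForm {m} (D : SMat (suc m) → Carrier) (D-cong : Respects≋ D)
                         (D-lin : RowLinear D) (D-alt : Alternating D) where

    open RowLinearForm D D-cong D-lin

    D-addRow : ∀ k p → k ≢ p → ∀ c (Z Z′ : SMat (suc m)) → (∀ i → i ≢ k → ∀ j → Z i j ≈ Z′ i j) →
      (∀ j → Z k j ≈ Z′ k j + c * Z′ p j) → D Z ≈ D Z′
    D-addRow k p k≢p c Z Z′ Z≈Z′ Zk = begin
      D Z              ≈⟨ D-lin k c X Z′ Z (λ i i≢k j → trans (setRow-≢ Z′ k _ i≢k j) (sym (Z≈Z′ i i≢k j)))
                            (λ i i≢k j → sym (Z≈Z′ i i≢k j))
                            (λ j → trans (Zk j) (trans (+-comm _ _) (+-congʳ (*-congˡ (sym (setRow-≡ Z′ k _ j)))))) ⟩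
      c * D X + D Z′   ≈⟨ +-congʳ (trans (*-congˡ D-X≈0) (zeroʳ c)) ⟩
      0# + D Z′        ≈⟨ +-identityˡ _ ⟩
      D Z′             ∎
      where
      X = setRow Z′ k (Z′ p)
      D-X≈0 : D X ≈ 0#
      D-X≈0 = D-alt k p k≢p X (λ j → trans (setRow-≡ Z′ k _ j) (sym (setRow-≢ Z′ k _ (k≢p ∘ ≡.sym) j)))

    addRow0 : (Fin m → Carrier) → SMat (suc m) → SMat (suc m)
    addRow0 cs Y zero    j = Y zero j
    addRow0 cs Y (suc a) j = Y (suc a) j + cs a * Y zero j

    -- induction on the number t of rows that actually get modified
    addRow0-upto : ∀ t Y cs → (∀ a → t ℕ.≤ toℕ a → cs a ≈ 0#) → D (addRow0 cs Y) ≈ D Y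
    addRow0-upto zero Y cs cs≈0 = D-cong λ
      { zero    j → refl
      ; (suc a) j → trans (+-congˡ (trans (*-congʳ (cs≈0 a ℕ.z≤n)) (zeroˡ _))) (+-identityʳ _) }
    addRow0-upto (suc t) Y cs cs≈0 with t ℕ.<? m
    ... | no t≮m = addRow0-upto t Y cs (λ a t≤a → ⊥-elim (t≮m (ℕP.≤-<-trans t≤a (FinP.toℕ<n a))))
    ... | yes t<m =
      trans (D-addRow (suc a₀) zero (λ ()) (cs a₀) _ _ off row-a₀) (addRow0-upto t Y cs′ cs′≈0)
      where
      a₀ = Fin.fromℕ< t<m
      cs′ = updateAt cs a₀ (λ _ → 0#)
      cs′-a₀ : cs′ a₀ ≈ 0#
      cs′-a₀ = reflexive (updateAt-updates a₀ cs)
      off : ∀ i → i ≢ suc a₀ → ∀ j → addRow0 cs Y i j ≈ addRow0 cs′ Y i j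
      off zero    _        j = refl
      off (suc a) a≢a₀ j = +-congˡ (*-congʳ (reflexive (≡.sym (updateAt-minimal a a₀ cs (a≢a₀ ∘ ≡.cong suc)))))
      row-a₀ : ∀ j → addRow0 cs Y (suc a₀) j ≈ addRow0 cs′ Y (suc a₀) j + cs a₀ * Y zero j
      row-a₀ j = +-congʳ (sym (trans (+-congˡ (trans (*-congʳ cs′-a₀) (zeroˡ _))) (+-identityʳ _)))
      cs′≈0 : ∀ a → t ℕ.≤ toℕ a → cs′ a ≈ 0#
      cs′≈0 a t≤a with a Fin.≟ a₀
      ... | yes ≡.refl = cs′-a₀
      ... | no a≢a₀    = trans (reflexive (updateAt-minimal a a₀ cs a≢a₀)) (cs≈0 a (ℕP.≤∧≢⇒< t≤a t≢a))
        where
        t≢a : t ≢ toℕ a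
        t≢a t≡a = a≢a₀ (FinP.toℕ-injective (≡.trans (≡.sym t≡a) (≡.sym (FinP.toℕ-fromℕ< t<m))))

    D-addRow0 : ∀ cs Y → D (addRow0 cs Y) ≈ D Y
    D-addRow0 cs Y = addRow0-upto m Y cs (λ a m≤a → ⊥-elim (ℕP.<⇒≱ (FinP.toℕ<n a) m≤a))

    -- pulling row j to the front multiplies D by sgn j; by induction on j,
    -- pull (suc j) is pull (inject₁ j) followed by exchanging rows 0 and suc j
    D-pull : ∀ j N → D (pull j N) ≈ sgn j * D N
    D-pull j N = D-pull-at (toℕ j) j N ≡.refl
      where
      D-pull-at : ∀ k j N → toℕ j ≡ k → D (pull j N) ≈ sgn j * D N
      D-pull-at _       zero    N _ = trans (D-cong (λ { zero b → refl ; (suc a) b → refl })) (sym (*-identityˡ _))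
      D-pull-at zero    (suc j) N ()
      D-pull-at (suc k) (suc j) N j+1≡k+1 = begin
        D (pull (suc j) N)         ≈⟨ D-exchange zero (suc j) (λ ()) (D-alt zero (suc j) (λ ())) X _ row-0 row-j others ⟩
        - D X                      ≈⟨ -‿cong (D-pull-at k (inject₁ j) N (≡.trans (FinP.toℕ-inject₁ j) (ℕP.suc-injective j+1≡k+1))) ⟩
        - (sgn (inject₁ j) * D N)  ≈⟨ -‿distribˡ-* _ _ ⟩
        - sgn (inject₁ j) * D N    ≡⟨ ≡.cong (λ s → - s * D N) (sgn-inject₁ j) ⟩
        sgn (suc j) * D N          ∎
        where
        X = pull (inject₁ j) N
        row-0 : ∀ b → pull (suc j) N zero b ≈ X (suc j) b
        row-0 b = reflexive (≡.cong (λ r → N r b) (≡.sym (punchIn-inject₁-self j)))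
        row-j : ∀ b → pull (suc j) N (suc j) b ≈ X zero b
        row-j b = reflexive (≡.cong (λ r → N r b) (punchIn-suc-self j))
        others : ∀ i → i ≢ zero → i ≢ suc j → ∀ b → pull (suc j) N i b ≈ X i b
        others zero    0≢0 _   b = ⊥-elim (0≢0 ≡.refl)
        others (suc a) _   a≢j b =
          reflexive (≡.cong (λ r → N r b) (≡.sym (punchIn-inject₁-suc j a (a≢j ∘ ≡.cong suc))))

  det-lin : ∀ {n} → RowLinear (det {n})
  det-lin {suc n} k a X Y Z X≈Z Y≈Z Zk = begin
    det Z                          ≈⟨ sum-cong term ⟩
    sum (λ i → a * tX i + tY i)    ≈⟨ sum-lin a tX tY ⟩
    a * det X + det Y              ∎
    where
    tX = λ i → sgn i * (X i zero * det (minor i zero X))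
    tY = λ i → sgn i * (Y i zero * det (minor i zero Y))
    -- row k enters through the entry Z k 0, the other rows through the minor
    term : ∀ i → sgn i * (Z i zero * det (minor i zero Z)) ≈ a * tX i + tY i
    term i with i Fin.≟ k
    ... | yes ≡.refl = begin
      sgn i * (Z i zero * dZ)                       ≈⟨ *-congˡ (*-congʳ (Zk zero)) ⟩
      sgn i * ((a * X i zero + Y i zero) * dZ)      ≈⟨ solve 5 (λ s a x y d → s :* ((a :* x :+ y) :* d) := a :* (s :* (x :* d)) :+ s :* (y :* d)) refl _ a _ _ _ ⟩
      a * (sgn i * (X i zero * dZ)) + sgn i * (Y i zero * dZ)
                                                    ≈⟨ +-cong (*-congˡ (*-congˡ (*-congˡ (minor-det X X≈Z)))) (*-congˡ (*-congˡ (minor-det Y Y≈Z))) ⟩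
      a * tX i + tY i                               ∎
      where
      dZ = det (minor i zero Z)
      minor-det : ∀ W → (∀ i′ → i′ ≢ i → ∀ j → W i′ j ≈ Z i′ j) → dZ ≈ det (minor i zero W)
      minor-det W W≈Z = det-cong (λ a′ b → sym (W≈Z (punchIn i a′) (punchInᵢ≢i i a′) (suc b)))
    ... | no i≢k = begin
      sgn i * (Z i zero * det (minor i zero Z))     ≈⟨ *-congˡ (*-congˡ minor-lin) ⟩
      sgn i * (Z i zero * (a * dX + dY))            ≈⟨ solve 5 (λ s a z x y → s :* (z :* (a :* x :+ y)) := a :* (s :* (z :* x)) :+ s :* (z :* y)) refl _ a _ _ _ ⟩
      a * (sgn i * (Z i zero * dX)) + sgn i * (Z i zero * dY)
                                                    ≈⟨ +-cong (*-congˡ (*-congˡ (*-congʳ (sym (X≈Z i i≢k zero))))) (*-congˡ (*-congʳ (sym (Y≈Z i i≢k zero)))) ⟩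
      a * tX i + tY i                               ∎
      where
      dX = det (minor i zero X)
      dY = det (minor i zero Y)
      k′ = punchOut i≢k
      k′↦k : punchIn i k′ ≡ k
      k′↦k = punchIn-punchOut i≢k
      off-k′ : ∀ a′ → a′ ≢ k′ → punchIn i a′ ≢ k
      off-k′ a′ a′≢k′ eq = a′≢k′ (punchIn-injective i a′ k′ (≡.trans eq (≡.sym k′↦k)))
      minor-lin : det (minor i zero Z) ≈ a * dX + dY
      minor-lin = det-lin k′ a (minor i zero X) (minor i zero Y) (minor i zero Z)
        (λ a′ ne b → X≈Z (punchIn i a′) (off-k′ a′ ne) (suc b))
        (λ a′ ne b → Y≈Z (punchIn i a′) (off-k′ a′ ne) (suc b))
        (λ b → ≡.subst (λ r → Z r (suc b) ≈ a * X r (suc b) + Y r (suc b)) (≡.sym k′↦k) (Zk (suc b)))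

  -- Rows 0 and q+1 equal: all terms but i = 0 and i = q+1 of the column
  -- expansion have a minor with two equal rows, and the two remaining terms
  -- cancel since minor (q+1) 0 M is minor 0 0 M with row q pulled to the front.
  det-alternating-row0 : ∀ {m} → Alternating (det {suc m}) → ∀ q → AlternatingAt (det {suc (suc m)}) zero (suc q)
  det-alternating-row0 {m} det-alt q M row0≈rowq = begin
    det M                                                 ≈⟨ +-congˡ (sum-single (λ i → t (suc i)) q others) ⟩
    t zero + t (suc q)                                    ≈⟨ +-congˡ (*-congˡ (*-cong (sym (row0≈rowq zero)) (det-cong pulled))) ⟩
    1# * (M zero zero * det N) + - sgn q * (M zero zero * det (pull q N))
                                                          ≈⟨ +-congˡ (*-congˡ (*-congˡ (D-pull q N))) ⟩
    1# * (M zero zero * det N) + - sgn q * (M zero zero * (sgn q * det N))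
                                                          ≈⟨ +-congʳ (*-identityˡ _) ⟩
    M zero zero * det N + - sgn q * (M zero zero * (sgn q * det N))
                                                          ≈⟨ solve 3 (λ s x d → x :* d :+ (:- s) :* (x :* (s :* d)) := x :* d :+ :- ((s :* s) :* (x :* d))) refl (sgn q) (M zero zero) (det N) ⟩
    M zero zero * det N + - ((sgn q * sgn q) * (M zero zero * det N))
                                                          ≈⟨ +-congˡ (-‿cong (trans (*-congʳ (sgn² q)) (*-identityˡ _))) ⟩
    M zero zero * det N + - (M zero zero * det N)         ≈⟨ -‿inverseʳ _ ⟩
    0#                                                    ∎
    where
    open AlternatingForm (det {suc m}) det-cong det-lin det-alt using (D-pull)
    t = λ i → sgn i * (M i zero * det (minor i zero M))
    N = minor zero zero M
    pulled : minor (suc q) zero M ≋ pull q N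
    pulled zero    b = row0≈rowq (suc b)
    pulled (suc a) b = refl
    others : ∀ i → i ≢ q → t (suc i) ≈ 0#
    others i i≢q = trans (*-congˡ (*-congˡ equal-rows)) (trans (*-congˡ (zeroʳ _)) (zeroʳ _))
      where
      q′ = punchOut {i = suc i} (i≢q ∘ suc-injective)
      q′↦q : punchIn (suc i) q′ ≡ suc q
      q′↦q = punchIn-punchOut (i≢q ∘ suc-injective)
      0≢q′ : zero ≢ q′
      0≢q′ 0≡q′ with ≡.subst (λ r → punchIn (suc i) r ≡ suc q) (≡.sym 0≡q′) q′↦q
      ... | ()
      equal-rows : det (minor (suc i) zero M) ≈ 0#
      equal-rows = det-alt zero q′ 0≢q′ (minor (suc i) zero M)
        (λ b → trans (row0≈rowq (suc b)) (reflexive (≡.cong (λ r → M r (suc b)) (≡.sym q′↦q))))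

  det-alt : ∀ {n} → Alternating (det {n})
  det-alt {suc zero}    = alternating-from-row0 det det-cong det-lin (λ ())
  det-alt {suc (suc m)} = alternating-from-row0 det det-cong det-lin (det-alternating-row0 det-alt)

  δ : ∀ {n} → SMat n
  δ zero    zero    = 1#
  δ zero    (suc _) = 0#
  δ (suc _) zero    = 0#
  δ (suc a) (suc b) = δ a b

  δ-diag : ∀ {n} (a : Fin n) → δ a a ≡ 1#
  δ-diag zero    = ≡.refl
  δ-diag (suc a) = δ-diag a

  δ-off : ∀ {n} (a b : Fin n) → a ≢ b → δ a b ≡ 0#
  δ-off zero    zero    a≢b = ⊥-elim (a≢b ≡.refl)
  δ-off zero    (suc b) _   = ≡.refl
  δ-off (suc a) zero    _   = ≡.refl
  δ-off (suc a) (suc b) a≢b = δ-off a b (a≢b ∘ ≡.cong suc)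

  δ-sym : ∀ {n} (a b : Fin n) → δ a b ≡ δ b a
  δ-sym zero    zero    = ≡.refl
  δ-sym zero    (suc b) = ≡.refl
  δ-sym (suc a) zero    = ≡.refl
  δ-sym (suc a) (suc b) = δ-sym a b

  δ-punchIn : ∀ {n} (j : Fin (suc n)) a b → δ (punchIn j a) (punchIn j b) ≡ δ a b
  δ-punchIn j a b with a Fin.≟ b
  ... | yes ≡.refl = ≡.trans (δ-diag (punchIn j a)) (≡.sym (δ-diag a))
  ... | no a≢b     = ≡.trans (δ-off _ _ (a≢b ∘ punchIn-injective j a b)) (≡.sym (δ-off a b a≢b))

  sum-δ : ∀ {n} (f : Fin n → Carrier) (j : Fin n) → sum (λ l → f l * δ l j) ≈ f j
  sum-δ f j = trans (sum-single _ j (λ l l≢j → trans (*-congˡ (reflexive (δ-off l j l≢j))) (zeroʳ _)))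
                    (trans (*-congˡ (reflexive (δ-diag j))) (*-identityʳ _))

  ins : ∀ {r} → Fin (suc r) → (Fin r → Carrier) → Fin (suc r) → Carrier
  ins j v = insertAt v j 0#

  ins-at : ∀ {r} (j : Fin (suc r)) v → ins j v j ≈ 0#
  ins-at j v = reflexive (insertAt-lookup v j 0#)

  ins-off : ∀ {r} (j b′ : Fin (suc r)) v (j≢b′ : j ≢ b′) → ins j v b′ ≈ v (punchOut j≢b′)
  ins-off j b′ v j≢b′ = reflexive (≡.trans (≡.cong (ins j v) (≡.sym (punchIn-punchOut j≢b′)))
                                          (insertAt-punchIn v j 0# (punchOut j≢b′)))

  ins-cong : ∀ {r} (j : Fin (suc r)) {v w} → (∀ b → v b ≈ w b) → ∀ b′ → ins j v b′ ≈ ins j w b′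
  ins-cong j {v} {w} v≈w b′ with j Fin.≟ b′
  ... | yes ≡.refl = trans (ins-at j v) (sym (ins-at j w))
  ... | no j≢b′    = trans (ins-off j b′ v j≢b′) (trans (v≈w _) (sym (ins-off j b′ w j≢b′)))

  ins-lin : ∀ {r} (j : Fin (suc r)) a v w z → (∀ b → z b ≈ a * v b + w b) →
            ∀ b′ → ins j z b′ ≈ a * ins j v b′ + ins j w b′
  ins-lin j a v w z z≈ b′ with j Fin.≟ b′
  ... | yes ≡.refl = trans (ins-at j z) (sym (trans (+-cong (trans (*-congˡ (ins-at j v)) (zeroʳ a)) (ins-at j w)) (+-identityʳ 0#)))
  ... | no j≢b′    = trans (ins-off j b′ z j≢b′) (trans (z≈ _) (sym (+-cong (*-congˡ (ins-off j b′ v j≢b′)) (ins-off j b′ w j≢b′))))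

  ins-δ : ∀ {r} (j : Fin (suc r)) a b′ → ins j (δ a) b′ ≈ δ (punchIn j a) b′
  ins-δ j a b′ with j Fin.≟ b′
  ... | yes ≡.refl = trans (ins-at j (δ a)) (reflexive (≡.sym (δ-off _ j (punchInᵢ≢i j a))))
  ... | no j≢b′    = trans (ins-off j b′ (δ a) j≢b′) (reflexive (≡.sym (≡.trans
      (≡.cong (δ (punchIn j a)) (≡.sym (punchIn-punchOut j≢b′))) (δ-punchIn j a (punchOut j≢b′)))))

  unitRowOver : ∀ {r} → Fin (suc r) → SMat r → SMat (suc r)
  unitRowOver j N zero    = δ j
  unitRowOver j N (suc a) = ins j (N a)

  -- On matrices with unit row e_j on top, an alternating form D restricts to
  -- an alternating form Dⱼ of the r × r matrix below it with column j deleted.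
  module UnitRowRestriction {r} (D : SMat (suc r) → Carrier) (D-cong : Respects≋ D)
                            (D-lin : RowLinear D) (D-alt : Alternating D) (j : Fin (suc r)) where

    open AlternatingForm D D-cong D-lin D-alt using (D-pull; D-addRow0; addRow0)

    Dⱼ : SMat r → Carrier
    Dⱼ N = D (unitRowOver j N)

    Dⱼ-cong : Respects≋ Dⱼ
    Dⱼ-cong N≋N′ = D-cong (λ { zero b → refl ; (suc a) b → ins-cong j (N≋N′ a) b })

    Dⱼ-lin : RowLinear Dⱼ
    Dⱼ-lin k a X Y Z X≈Z Y≈Z Zk = D-lin (suc k) a (unitRowOver j X) (unitRowOver j Y) (unitRowOver j Z)
      (λ { zero _ b → refl ; (suc i) i≢k b → ins-cong j (X≈Z i (i≢k ∘ ≡.cong suc)) b })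
      (λ { zero _ b → refl ; (suc i) i≢k b → ins-cong j (Y≈Z i (i≢k ∘ ≡.cong suc)) b })
      (ins-lin j a (X k) (Y k) (Z k) Zk)

    Dⱼ-alt : Alternating Dⱼ
    Dⱼ-alt p q p≢q N Np≈Nq = D-alt (suc p) (suc q) (p≢q ∘ suc-injective) (unitRowOver j N) (ins-cong j Np≈Nq)

    Dⱼ-δ : Dⱼ δ ≈ sgn j * D δ
    Dⱼ-δ = trans (D-cong (λ { zero b → refl ; (suc a) b → ins-δ j a b })) (D-pull j δ)

    -- subtracting M (a+1) j times row 0 = e_j from each row a+1 clears column j
    D-unitRow : ∀ M → D (setRow M zero (δ j)) ≈ Dⱼ (minor zero j M)
    D-unitRow M = trans (sym (D-addRow0 cs Y)) (D-cong cleared)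
      where
      Y = setRow M zero (δ j)
      N = minor zero j M
      cs = λ a → - M (suc a) j
      cleared : addRow0 cs Y ≋ unitRowOver j N
      cleared zero    b′ = setRow-≡ M zero (δ j) b′
      cleared (suc a) b′ with j Fin.≟ b′
      ... | yes ≡.refl = begin
        Y (suc a) j + - M (suc a) j * Y zero j    ≈⟨ +-cong (setRow-≢ M zero (δ j) (λ ()) j) (*-congˡ (trans (setRow-≡ M zero (δ j) j) (reflexive (δ-diag j)))) ⟩
        M (suc a) j + - M (suc a) j * 1#          ≈⟨ +-congˡ (*-identityʳ _) ⟩
        M (suc a) j + - M (suc a) j               ≈⟨ -‿inverseʳ _ ⟩
        0#                                        ≈⟨ ins-at j (N a) ⟨
        ins j (N a) j                             ∎
      ... | no j≢b′ = begin
        Y (suc a) b′ + - M (suc a) j * Y zero b′  ≈⟨ +-cong (setRow-≢ M zero (δ j) (λ ()) b′) (*-congˡ (trans (setRow-≡ M zero (δ j) b′) (reflexive (δ-off j b′ j≢b′)))) ⟩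
        M (suc a) b′ + - M (suc a) j * 0#         ≈⟨ trans (+-congˡ (zeroʳ _)) (+-identityʳ _) ⟩
        M (suc a) b′                              ≡⟨ ≡.cong (M (suc a)) (punchIn-punchOut j≢b′) ⟨
        N a (punchOut j≢b′)                       ≈⟨ ins-off j b′ (N a) j≢b′ ⟨
        ins j (N a) b′                            ∎

  -- Expand row 0 as
  -- Σ_j M 0 j · e_j; the term with row 0 = e_j is Dⱼ (minor 0 j M), which
  -- by induction is det′ (minor 0 j M) · Dⱼ δ = det′ (minor 0 j M) · sgn j · D δ.
  alternating-unique : ∀ {n} (D : SMat n → Carrier) → Respects≋ D → RowLinear D → Alternating D →
    ∀ M → D M ≈ det′ M * D δ
  alternating-unique {zero}  D D-cong D-lin D-alt M = trans (D-cong (λ ())) (sym (*-identityˡ _))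
  alternating-unique {suc r} D D-cong D-lin D-alt M = begin
    D M                                             ≈⟨ D-expand zero (M zero) δ M (λ j → sym (sum-δ (M zero) j)) ⟩
    sum (λ j → M zero j * D (setRow M zero (δ j)))  ≈⟨ sum-cong (λ j → *-congˡ {M zero j} (unit-row0 j)) ⟩
    sum (λ j → M zero j * (det′ (minor zero j M) * (sgn j * D δ)))
        ≈⟨ sum-cong (λ j → solve 4 (λ s m d x → m :* (d :* (s :* x)) := (s :* (m :* d)) :* x) refl (sgn j) (M zero j) (det′ (minor zero j M)) (D δ)) ⟩
    sum (λ j → (sgn j * (M zero j * det′ (minor zero j M))) * D δ)
        ≈⟨ *-distribʳ-sum (D δ) (λ j → sgn j * (M zero j * det′ (minor zero j M))) ⟨
    det′ M * D δ                                    ∎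
    where
    open RowLinearForm D D-cong D-lin using (D-expand)
    unit-row0 : ∀ j → D (setRow M zero (δ j)) ≈ det′ (minor zero j M) * (sgn j * D δ)
    unit-row0 j = begin
      D (setRow M zero (δ j))           ≈⟨ D-unitRow M ⟩
      Dⱼ (minor zero j M)               ≈⟨ alternating-unique Dⱼ Dⱼ-cong Dⱼ-lin Dⱼ-alt (minor zero j M) ⟩
      det′ (minor zero j M) * Dⱼ δ      ≈⟨ *-congˡ Dⱼ-δ ⟩
      det′ (minor zero j M) * (sgn j * D δ) ∎
      where open UnitRowRestriction D D-cong D-lin D-alt j

  det-δ : ∀ {n} → det (δ {n}) ≈ 1#
  det-δ {zero}  = refl
  det-δ {suc n} = begin
    det (δ {suc n})                           ≈⟨ sum-single (λ i → sgn i * (δ i zero * det (minor i zero (δ {suc n})))) zero (λ { zero 0≢0 → ⊥-elim (0≢0 ≡.refl) ; (suc i) _ → trans (*-congˡ (zeroˡ _)) (zeroʳ _) }) ⟩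
    1# * (1# * det (δ {n}))                   ≈⟨ trans (*-identityˡ _) (*-identityˡ _) ⟩
    det (δ {n})                               ≈⟨ det-δ {n} ⟩
    1#                                        ∎

  det≈det′ : ∀ {n} (M : SMat n) → det M ≈ det′ M
  det≈det′ {n} M = trans (alternating-unique det det-cong det-lin det-alt M)
                         (trans (*-congˡ (det-δ {n})) (*-identityʳ _))

  det-zero-row : ∀ {n} (k : Fin n) (M : SMat n) → (∀ j → M k j ≈ 0#) → det M ≈ 0#
  det-zero-row = RowLinearForm.D-zero det det-cong det-lin

  _ᵀ : ∀ {m n} → Mat m n → Mat n m
  (M ᵀ) i j = M j i

  -- the column expansion of Mᵀ is the row expansion of M
  det-ᵀ : ∀ {n} (M : SMat n) → det (M ᵀ) ≈ det M
  det-ᵀ M = trans (column-is-row M) (sym (det≈det′ M))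
    where
    column-is-row : ∀ {n} (M : SMat n) → det (M ᵀ) ≈ det′ M
    column-is-row {zero}  M = refl
    column-is-row {suc n} M = sum-cong (λ i → *-congˡ {sgn i} (*-congˡ {M zero i} (column-is-row (minor zero i M))))

  infixl 7 _⊗_
  _⊗_ : ∀ {m k n} → Mat m k → Mat k n → Mat m n
  (A ⊗ B) i j = sum (λ l → A i l * B l j)

  ⊗-cong : ∀ {m k n} {A A′ : Mat m k} {B B′ : Mat k n} → A ≋ A′ → B ≋ B′ → A ⊗ B ≋ A′ ⊗ B′
  ⊗-cong A≋A′ B≋B′ i j = sum-cong (λ l → *-cong (A≋A′ i l) (B≋B′ l j))

  ⊗-assoc : ∀ {m k p n} (A : Mat m k) (B : Mat k p) (C : Mat p n) → (A ⊗ B) ⊗ C ≋ A ⊗ (B ⊗ C)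
  ⊗-assoc A B C i j = begin
    sum (λ l → sum (λ q → A i q * B q l) * C l j)    ≈⟨ sum-cong (λ l → *-distribʳ-sum (C l j) (λ q → A i q * B q l)) ⟩
    sum (λ l → sum (λ q → (A i q * B q l) * C l j))  ≈⟨ ∑-comm (λ l q → (A i q * B q l) * C l j) ⟩
    sum (λ q → sum (λ l → (A i q * B q l) * C l j))  ≈⟨ sum-cong (λ q → sum-cong (λ l → *-assoc (A i q) (B q l) (C l j))) ⟩
    sum (λ q → sum (λ l → A i q * (B q l * C l j)))  ≈⟨ sum-cong (λ q → *-distribˡ-sum (A i q) (λ l → B q l * C l j)) ⟨
    sum (λ q → A i q * sum (λ l → B q l * C l j))    ∎

  ⊗-ᵀ : ∀ {m k n} (A : Mat m k) (B : Mat k n) → (A ⊗ B) ᵀ ≋ B ᵀ ⊗ A ᵀ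
  ⊗-ᵀ A B i j = sum-cong (λ l → *-comm (A j l) (B l i))

  δ-⊗ : ∀ {m n} (B : Mat m n) → δ ⊗ B ≋ B
  δ-⊗ B i j = trans (sum-cong (λ l → trans (*-congʳ (reflexive (δ-sym i l))) (*-comm _ _))) (sum-δ (λ l → B l j) i)

  -- Product formula: A ↦ det (A ⊗ B) is an alternating row-linear form.
  det-mul : ∀ {n} (A B : SMat n) → det (A ⊗ B) ≈ det A * det B
  det-mul A B = begin
    det (A ⊗ B)           ≈⟨ alternating-unique D D-cong D-lin D-alt A ⟩
    det′ A * det (δ ⊗ B)  ≈⟨ *-cong (sym (det≈det′ A)) (det-cong (δ-⊗ B)) ⟩
    det A * det B         ∎
    where
    D = λ A′ → det (A′ ⊗ B)
    D-cong : Respects≋ D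
    D-cong A≋A′ = det-cong (⊗-cong A≋A′ (λ _ _ → refl))
    D-lin : RowLinear D
    D-lin k a X Y Z X≈Z Y≈Z Zk = det-lin k a (X ⊗ B) (Y ⊗ B) (Z ⊗ B)
      (λ i i≢k j → sum-cong (λ l → *-congʳ (X≈Z i i≢k l)))
      (λ i i≢k j → sum-cong (λ l → *-congʳ (Y≈Z i i≢k l)))
      (λ j → trans (sum-cong (λ l → trans (*-congʳ (Zk l)) (distribʳ-scaled a (X k l) (Y k l) (B l j))))
                   (sum-lin a (λ l → X k l * B l j) (λ l → Y k l * B l j)))
      where
      distribʳ-scaled : ∀ a x y b → (a * x + y) * b ≈ a * (x * b) + y * b
      distribʳ-scaled = solve 4 (λ a x y b → (a :* x :+ y) :* b := a :* (x :* b) :+ y :* b) refl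
    D-alt : Alternating D
    D-alt p q p≢q A′ Ap≈Aq = det-alt p q p≢q (A′ ⊗ B) (λ j → sum-cong (λ l → *-congʳ (Ap≈Aq l)))

module DeterminantImage {c ℓ} (R : CommutativeRing c ℓ) where

  open import Data.Nat using (zero; suc)
  open import Data.Integer as ℤ using (ℤ)
  import Data.Integer.Properties as ℤP
  open import Data.Fin using (Fin; zero; suc)
  open import Function using (_∘_)
  open CommutativeRing R hiding (zero)
  open IntegerImage R using (intᴿ; intᴿ-+; intᴿ-*; intᴿ-neg)
  module Dℤ = Determinant ℤP.+-*-commutativeRing
  module Dᴿ = Determinant R

  intᴿ-sum : ∀ {m} (f : Fin m → ℤ) → intᴿ (Dℤ.sum f) ≈ Dᴿ.sum (intᴿ ∘ f)
  intᴿ-sum {zero}  f = refl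
  intᴿ-sum {suc m} f = trans (intᴿ-+ (f zero) (Dℤ.sum (f ∘ suc))) (+-congˡ (intᴿ-sum (f ∘ suc)))

  intᴿ-sgn : ∀ {m} (i : Fin m) → intᴿ (Dℤ.sgn i) ≈ Dᴿ.sgn i
  intᴿ-sgn zero    = +-identityʳ 1#
  intᴿ-sgn (suc i) = trans (intᴿ-neg (Dℤ.sgn i)) (-‿cong (intᴿ-sgn i))

  intᴿ-det : ∀ {m} (M : Dℤ.SMat m) → intᴿ (Dℤ.det M) ≈ Dᴿ.det (λ i j → intᴿ (M i j))
  intᴿ-det {zero}  M = +-identityʳ 1#
  intᴿ-det {suc m} M = trans (intᴿ-sum (λ i → Dℤ.sgn i ℤ.* (M i zero ℤ.* Dℤ.det (Dℤ.minor i zero M)))) (Dᴿ.sum-cong (λ i →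
    trans (intᴿ-* (Dℤ.sgn i) (M i zero ℤ.* Dℤ.det (Dℤ.minor i zero M))) (*-cong (intᴿ-sgn i)
      (trans (intᴿ-* (M i zero) (Dℤ.det (Dℤ.minor i zero M))) (*-congˡ (intᴿ-det (Dℤ.minor i zero M)))))))

-- Hadamard's inequality over ℤ, in the form det (A Aᵀ) ≤ ∏ᵢ ‖Aᵢ‖², proved
-- by Gram–Schmidt-style elimination with integer arithmetic, and its
-- consequence |det M|² ≤ r^r for r × r matrices with 0/1 entries.
module Hadamard where

  open import Data.Nat as ℕ using (ℕ; zero; suc)
  open import Data.Integer as ℤ using (ℤ; +_; -[1+_]; +[1+_]; _≤_; _<_; +≤+; +<+; 0ℤ; 1ℤ; _+_; _*_; -_)
  import Data.Integer.Properties as ℤP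
  open import Data.Integer.Tactic.RingSolver using (solve-∀)
  open import Data.Fin using (Fin; zero; suc)
  open import Data.Product using (_×_; _,_; proj₁; proj₂)
  open import Data.Sum using (_⊎_; inj₁; inj₂)
  open import Relation.Nullary using (yes; no)
  import Relation.Binary.PropositionalEquality
  open Relation.Binary.PropositionalEquality using (_≡_; _≢_; refl; cong; cong₂; sym; trans; subst)
  open import Data.Empty using (⊥-elim)
  open import Function using (_∘_)

  open Determinant ℤP.+-*-commutativeRing
    using (Mat; SMat; _≋_; det; det′; _⊗_; _ᵀ; δ; sgn; minor; sum; sum-cong; sum-lin; sum-zero; sum-single;
           det-cong; det-mul; det-ᵀ; det≈det′; det-zero-row; ⊗-cong; ⊗-assoc; ⊗-ᵀ; δ-diag; δ-off)
  open import Algebra.Properties.Semiring.Sum (ℤP.+-*-semiring) using (*-distribˡ-sum)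

  square-nonneg : ∀ x → 0ℤ ≤ x * x
  square-nonneg (+ zero)  = +≤+ ℕ.z≤n
  square-nonneg +[1+ n ] = +≤+ ℕ.z≤n
  square-nonneg -[1+ n ] = +≤+ ℕ.z≤n

  square≡0 : ∀ x → x * x ≡ 0ℤ → x ≡ 0ℤ
  square≡0 (+ zero)  _  = refl
  square≡0 +[1+ n ] ()
  square≡0 -[1+ n ] ()

  +-nonneg : ∀ {a b} → 0ℤ ≤ a → 0ℤ ≤ b → 0ℤ ≤ a + b
  +-nonneg (+≤+ _) (+≤+ _) = +≤+ ℕ.z≤n

  *-nonneg : ∀ {a b} → 0ℤ ≤ a → 0ℤ ≤ b → 0ℤ ≤ a * b
  *-nonneg {+ zero}    {b}         _ _ = +≤+ ℕ.z≤n
  *-nonneg {+[1+ n ]} {+ zero}    _ _ = subst (0ℤ ≤_) (sym (ℤP.*-zeroʳ +[1+ n ])) (+≤+ ℕ.z≤n)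
  *-nonneg {+[1+ n ]} {+[1+ m ]} _ _ = +≤+ ℕ.z≤n

  *-pos : ∀ {a b} → 0ℤ < a → 0ℤ < b → 0ℤ < a * b
  *-pos {+[1+ n ]} {+[1+ m ]} _         _         = +<+ (ℕ.s≤s ℕ.z≤n)
  *-pos {+ zero}    {_}         (+<+ ()) _
  *-pos {+[1+ n ]} {+ zero}    _         (+<+ ())

  sum-nonneg : ∀ {n} (f : Fin n → ℤ) → (∀ i → 0ℤ ≤ f i) → 0ℤ ≤ sum f
  sum-nonneg {zero}  f f≥0 = +≤+ ℕ.z≤n
  sum-nonneg {suc n} f f≥0 = +-nonneg (f≥0 zero) (sum-nonneg (f ∘ suc) (f≥0 ∘ suc))

  +-nonneg≡0 : ∀ {a b} → 0ℤ ≤ a → 0ℤ ≤ b → a + b ≡ 0ℤ → a ≡ 0ℤ × b ≡ 0ℤ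
  +-nonneg≡0 {+ zero}    {+ zero}    _ _ _ = refl , refl
  +-nonneg≡0 {+ zero}    {+[1+ m ]} _ _ ()
  +-nonneg≡0 {+[1+ n ]} {+ m}       _ _ ()

  sum-nonneg≡0 : ∀ {n} (f : Fin n → ℤ) → (∀ i → 0ℤ ≤ f i) → sum f ≡ 0ℤ → ∀ i → f i ≡ 0ℤ
  sum-nonneg≡0 {suc n} f f≥0 Σ≡0 zero    = proj₁ (+-nonneg≡0 (f≥0 zero) (sum-nonneg (f ∘ suc) (f≥0 ∘ suc)) Σ≡0)
  sum-nonneg≡0 {suc n} f f≥0 Σ≡0 (suc i) =
    sum-nonneg≡0 (f ∘ suc) (f≥0 ∘ suc) (proj₂ (+-nonneg≡0 (f≥0 zero) (sum-nonneg (f ∘ suc) (f≥0 ∘ suc)) Σ≡0)) i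

  sum-≤-count : ∀ {n} (f : Fin n → ℤ) → (∀ i → f i ≤ 1ℤ) → sum f ≤ + n
  sum-≤-count {zero}  f f≤1 = ℤP.≤-refl
  sum-≤-count {suc n} f f≤1 =
    subst (sum f ≤_) (ℤP.pos-+ 1 n) (ℤP.+-mono-≤ (f≤1 zero) (sum-≤-count (f ∘ suc) (f≤1 ∘ suc)))

  ∏ : ∀ {n} → (Fin n → ℤ) → ℤ
  ∏ {zero}  f = 1ℤ
  ∏ {suc n} f = f zero * ∏ (f ∘ suc)

  ∏-nonneg : ∀ {n} (f : Fin n → ℤ) → (∀ i → 0ℤ ≤ f i) → 0ℤ ≤ ∏ f
  ∏-nonneg {zero}  f f≥0 = +≤+ ℕ.z≤n
  ∏-nonneg {suc n} f f≥0 = *-nonneg (f≥0 zero) (∏-nonneg (f ∘ suc) (f≥0 ∘ suc))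

  ∏-mono : ∀ {n} (f g : Fin n → ℤ) → (∀ i → 0ℤ ≤ f i) → (∀ i → f i ≤ g i) → ∏ f ≤ ∏ g
  ∏-mono {zero}  f g f≥0 f≤g = ℤP.≤-refl
  ∏-mono {suc n} f g f≥0 f≤g = ℤP.≤-trans
    (ℤP.*-monoʳ-≤-nonNeg (∏ (f ∘ suc)) {{ℤ.nonNegative (∏-nonneg (f ∘ suc) (f≥0 ∘ suc))}} (f≤g zero))
    (ℤP.*-monoˡ-≤-nonNeg (g zero) {{ℤ.nonNegative (ℤP.≤-trans (f≥0 zero) (f≤g zero))}}
      (∏-mono (f ∘ suc) (g ∘ suc) (f≥0 ∘ suc) (f≤g ∘ suc)))

  ∏-scale : ∀ {n} x (f : Fin n → ℤ) → ∏ (λ i → x * f i) ≡ x ℤ.^ n * ∏ f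
  ∏-scale {zero}  x f = refl
  ∏-scale {suc n} x f = trans (cong (x * f zero *_) (∏-scale x (f ∘ suc))) (interchange x (f zero) (x ℤ.^ n) (∏ (f ∘ suc)))
    where
    interchange : ∀ a b c d → a * b * (c * d) ≡ a * c * (b * d)
    interchange = solve-∀

  ∏-const : ∀ n x → ∏ {n} (λ _ → x) ≡ x ℤ.^ n
  ∏-const zero    x = refl
  ∏-const (suc n) x = cong (x *_) (∏-const n x)

  ^-pos : ∀ {x} n → 0ℤ < x → 0ℤ < x ℤ.^ n
  ^-pos zero    x>0 = +<+ (ℕ.s≤s ℕ.z≤n)
  ^-pos (suc n) x>0 = *-pos x>0 (^-pos n x>0)

  pos-^ : ∀ r n → (+ r) ℤ.^ n ≡ + (r ℕ.^ n)
  pos-^ r zero    = refl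
  pos-^ r (suc n) = trans (cong (+ r *_) (pos-^ r n)) (sym (ℤP.pos-* r (r ℕ.^ n)))

  square≡∣∣² : ∀ d → d * d ≡ + (ℤ.∣ d ∣ ℕ.* ℤ.∣ d ∣)
  square≡∣∣² (+ zero)  = refl
  square≡∣∣² +[1+ n ] = refl
  square≡∣∣² -[1+ n ] = refl

  det-row0-single : ∀ {n} (M : SMat (suc n)) → (∀ j → M zero (suc j) ≡ 0ℤ) →
    det M ≡ M zero zero * det (minor zero zero M)
  det-row0-single M zeros = begin
    det M                                          ≡⟨ det≈det′ M ⟩
    det′ M                                         ≡⟨ sum-single (λ j → sgn j * (M zero j * det′ (minor zero j M))) zero off-0 ⟩
    1ℤ * (M zero zero * det′ (minor zero zero M))  ≡⟨ ℤP.*-identityˡ _ ⟩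
    M zero zero * det′ (minor zero zero M)         ≡⟨ cong (M zero zero *_) (det≈det′ (minor zero zero M)) ⟨
    M zero zero * det (minor zero zero M)          ∎
    where
    open Relation.Binary.PropositionalEquality.≡-Reasoning
    off-0 : ∀ j → j ≢ zero → sgn j * (M zero j * det′ (minor zero j M)) ≡ 0ℤ
    off-0 zero    0≢0 = ⊥-elim (0≢0 refl)
    off-0 (suc j) _   = trans (cong (λ x → sgn (suc j) * (x * det′ (minor zero (suc j) M))) (zeros j))
                              (ℤP.*-zeroʳ (sgn (suc j)))

  det-scalar : ∀ {n} x → det {n} (λ a b → x * δ a b) ≡ x ℤ.^ n
  det-scalar {zero}  x = refl
  det-scalar {suc n} x = begin
    det {suc n} (λ a b → x * δ a b)       ≡⟨ det-row0-single {n} (λ a b → x * δ a b) (λ j → ℤP.*-zeroʳ x) ⟩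
    x * 1ℤ * det {n} (λ a b → x * δ a b)  ≡⟨ cong₂ _*_ (ℤP.*-identityʳ x) (det-scalar {n} x) ⟩
    x * x ℤ.^ n                           ∎
    where open Relation.Binary.PropositionalEquality.≡-Reasoning

  gram : ∀ {k m} → Mat k m → SMat k
  gram A = A ⊗ A ᵀ

  gram-diag-nonneg : ∀ {k m} (A : Mat k m) i → 0ℤ ≤ gram A i i
  gram-diag-nonneg A i = sum-nonneg (λ l → A i l * A i l) (λ l → square-nonneg (A i l))

  -- gram (E A) = E (gram A) Eᵀ, hence det (gram (E A)) = (det E)² det (gram A)
  det-gram-⊗ : ∀ {k m} (E : SMat k) (A : Mat k m) → det (gram (E ⊗ A)) ≡ det E * det E * det (gram A)
  det-gram-⊗ E A = begin
    det (gram (E ⊗ A))                       ≡⟨ det-cong gram-EA ⟩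
    det (E ⊗ (gram A ⊗ E ᵀ))                 ≡⟨ det-mul E (gram A ⊗ E ᵀ) ⟩
    det E * det (gram A ⊗ E ᵀ)               ≡⟨ cong (det E *_) (det-mul (gram A) (E ᵀ)) ⟩
    det E * (det (gram A) * det (E ᵀ))       ≡⟨ cong (λ d → det E * (det (gram A) * d)) (det-ᵀ E) ⟩
    det E * (det (gram A) * det E)           ≡⟨ reorder (det E) (det (gram A)) ⟩
    det E * det E * det (gram A)             ∎
    where
    open Relation.Binary.PropositionalEquality.≡-Reasoning
    reorder : ∀ e d → e * (d * e) ≡ e * e * d
    reorder = solve-∀
    gram-EA : gram (E ⊗ A) ≋ E ⊗ (gram A ⊗ E ᵀ)
    gram-EA i j = begin
      gram (E ⊗ A) i j                   ≡⟨ ⊗-cong {A = E ⊗ A} (λ _ _ → refl) (⊗-ᵀ E A) i j ⟩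
      ((E ⊗ A) ⊗ (A ᵀ ⊗ E ᵀ)) i j         ≡⟨ ⊗-assoc E A (A ᵀ ⊗ E ᵀ) i j ⟩
      (E ⊗ (A ⊗ (A ᵀ ⊗ E ᵀ))) i j         ≡⟨ ⊗-cong {A = E} (λ _ _ → refl) (λ i′ j′ → sym (⊗-assoc A (A ᵀ) (E ᵀ) i′ j′)) i j ⟩
      (E ⊗ (gram A ⊗ E ᵀ)) i j            ∎

  -- a row of norm 0 is zero, so gram A has a zero row
  det-gram-zero-norm : ∀ {k m} (A : Mat (suc k) m) → gram A zero zero ≡ 0ℤ → det (gram A) ≡ 0ℤ
  det-gram-zero-norm {m = m} A ‖A₀‖≡0 = det-zero-row zero (gram A) (λ j → trans
    (sum-cong {f = λ l → A zero l * A j l} (λ l → trans (cong (_* A j l) (row0≡0 l)) (ℤP.*-zeroˡ (A j l))))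
    (sum-zero {m} (λ _ → 0ℤ) (λ _ → refl)))
    where
    row0≡0 : ∀ l → A zero l ≡ 0ℤ
    row0≡0 l = square≡0 _ (sum-nonneg≡0 (λ l → A zero l * A zero l) (λ l → square-nonneg (A zero l)) ‖A₀‖≡0 l)

  -- With g = ‖A₀‖² and cᵢ = ⟨Aᵢ₊₁, A₀⟩, replacing
  -- row i+1 by g·Aᵢ₊₁ − cᵢ·A₀ makes every other row orthogonal to row 0.
  -- This is A′ = E A for a triangular E with det E = gᵏ.
  module Elimination {k m} (A : Mat (suc k) m) where

    g : ℤ
    g = gram A zero zero

    c : Fin k → ℤ
    c i = gram A (suc i) zero

    a : Fin k → ℤ
    a i = gram A (suc i) (suc i)

    E : SMat (suc k)
    E zero    zero    = 1ℤ
    E zero    (suc j) = 0ℤ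
    E (suc i) zero    = - c i
    E (suc i) (suc j) = g * δ i j

    A′ : Mat (suc k) m
    A′ zero    l = A zero l
    A′ (suc i) l = - c i * A zero l + g * A (suc i) l

    B : Mat k m
    B i = A′ (suc i)

    A′≋EA : A′ ≋ E ⊗ A
    A′≋EA zero    l = sym (trans (cong₂ _+_ (ℤP.*-identityˡ (A zero l)) (sum-zero _ (λ j → ℤP.*-zeroˡ (A (suc j) l)))) (ℤP.+-identityʳ _))
    A′≋EA (suc i) l = cong (_+_ (- c i * A zero l)) (sym (trans
      (sum-single (λ j → g * δ i j * A (suc j) l) i (λ j j≢i → trans (cong (λ d → g * d * A (suc j) l) (δ-off i j (j≢i ∘ sym))) (g0y g (A (suc j) l))))
      (trans (cong (λ d → g * d * A (suc i) l) (δ-diag i)) (g1y g (A (suc i) l)))))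
      where
      g0y : ∀ g y → g * 0ℤ * y ≡ 0ℤ
      g0y = solve-∀
      g1y : ∀ g y → g * 1ℤ * y ≡ g * y
      g1y = solve-∀

    det-E : det E ≡ g ℤ.^ k
    det-E = trans (det-row0-single E (λ _ → refl)) (trans (ℤP.*-identityˡ _) (det-scalar {k} g))

    orthogonal : ∀ j → gram A′ zero (suc j) ≡ 0ℤ
    orthogonal j = begin
      sum (λ l → A zero l * (- c j * A zero l + g * A (suc j) l))
        ≡⟨ sum-cong (λ l → expand (A zero l) (c j) g (A (suc j) l)) ⟩
      sum (λ l → - c j * (A zero l * A zero l) + g * (A (suc j) l * A zero l))
        ≡⟨ sum-lin (- c j) (λ l → A zero l * A zero l) (λ l → g * (A (suc j) l * A zero l)) ⟩
      - c j * g + sum (λ l → g * (A (suc j) l * A zero l))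
        ≡⟨ cong (_+_ (- c j * g)) (*-distribˡ-sum g (λ l → A (suc j) l * A zero l)) ⟨
      - c j * g + g * c j
        ≡⟨ cancel (c j) g ⟩
      0ℤ ∎
      where
      open Relation.Binary.PropositionalEquality.≡-Reasoning
      expand : ∀ x c g y → x * (- c * x + g * y) ≡ - c * (x * x) + g * (y * x)
      expand = solve-∀
      cancel : ∀ c g → - c * g + g * c ≡ 0ℤ
      cancel = solve-∀

    det-gram-A′ : det (gram A′) ≡ g * det (gram B)
    det-gram-A′ = det-row0-single (gram A′) orthogonal

    gram-B-diag : ∀ i → gram B i i + g * (c i * c i) ≡ g * (g * a i)
    gram-B-diag i = begin
      sum (λ l → B i l * B i l) + g * (c i * c i)
        ≡⟨ cong (_+ g * (c i * c i)) (sum-cong (λ l → expand (c i) g (A zero l) (A (suc i) l))) ⟩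
      sum (λ l → c i * c i * (A zero l * A zero l) + (- (c i + c i) * g * (A (suc i) l * A zero l) + g * g * (A (suc i) l * A (suc i) l))) + g * (c i * c i)
        ≡⟨ cong (_+ g * (c i * c i)) (trans (sum-lin (c i * c i) (λ l → A zero l * A zero l) rest) (cong (_+_ (c i * c i * g))
             (trans (sum-lin (- (c i + c i) * g) (λ l → A (suc i) l * A zero l) (λ l → g * g * (A (suc i) l * A (suc i) l))) (cong (_+_ (- (c i + c i) * g * c i))
               (sym (*-distribˡ-sum (g * g) (λ l → A (suc i) l * A (suc i) l))))))) ⟩
      c i * c i * g + (- (c i + c i) * g * c i + g * g * a i) + g * (c i * c i)
        ≡⟨ collect (c i) g (a i) ⟩
      g * (g * a i) ∎
      where
      open Relation.Binary.PropositionalEquality.≡-Reasoning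
      expand : ∀ c g x y → (- c * x + g * y) * (- c * x + g * y)
                         ≡ c * c * (x * x) + (- (c + c) * g * (y * x) + g * g * (y * y))
      expand = solve-∀
      rest = λ l → - (c i + c i) * g * (A (suc i) l * A zero l) + g * g * (A (suc i) l * A (suc i) l)
      collect : ∀ c g a → c * c * g + (- (c + c) * g * c + g * g * a) + g * (c * c) ≡ g * (g * a)
      collect = solve-∀

    gram-B-bound : 0ℤ < g → ∀ i → gram B i i ≤ g * (g * a i)
    gram-B-bound g>0 i = subst (gram B i i ≤_) (gram-B-diag i)
      (ℤP.i≤i+j (gram B i i) (g * (c i * c i)) {{ℤ.nonNegative (*-nonneg (ℤP.<⇒≤ g>0) (square-nonneg (c i)))}})

  hadamard-gram : ∀ k {m} (A : Mat k m) → det (gram A) ≤ ∏ (λ i → gram A i i)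
  hadamard-gram zero    A = ℤP.≤-refl
  hadamard-gram (suc k) A with gram A zero zero ℤ.≟ 0ℤ
  ... | yes g≡0 = subst (_≤ ∏ (λ i → gram A i i)) (sym (det-gram-zero-norm A g≡0)) (∏-nonneg _ (gram-diag-nonneg A))
  ... | no g≢0 = ℤP.*-cancelˡ-≤-pos (det (gram A)) (g * ∏ a) (gᵏ * gᵏ) {{ℤ.positive (*-pos gᵏ>0 gᵏ>0)}} (begin
    gᵏ * gᵏ * det (gram A)           ≡⟨ cong (λ d → d * d * det (gram A)) det-E ⟨
    det E * det E * det (gram A)     ≡⟨ det-gram-⊗ E A ⟨
    det (gram (E ⊗ A))               ≡⟨ det-cong (⊗-cong {A = E ⊗ A} (λ i l → sym (A′≋EA i l)) (λ l i → sym (A′≋EA i l))) ⟩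
    det (gram A′)                    ≡⟨ det-gram-A′ ⟩
    g * det (gram B)                 ≤⟨ ℤP.*-monoˡ-≤-nonNeg g {{ℤ.nonNegative g≥0}} (hadamard-gram k B) ⟩
    g * ∏ (λ i → gram B i i)         ≤⟨ ℤP.*-monoˡ-≤-nonNeg g {{ℤ.nonNegative g≥0}}
                                          (∏-mono _ _ (gram-diag-nonneg B) (gram-B-bound g>0)) ⟩
    g * ∏ (λ i → g * (g * a i))      ≡⟨ cong (g *_) (trans (∏-scale {k} g (λ i → g * a i)) (cong (gᵏ *_) (∏-scale {k} g a))) ⟩
    g * (gᵏ * (gᵏ * ∏ a))            ≡⟨ reorder g gᵏ (∏ a) ⟩
    gᵏ * gᵏ * (g * ∏ a)              ∎)
    where
    open Elimination A
    open ℤP.≤-Reasoning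
    gᵏ = g ℤ.^ k
    g≥0 : 0ℤ ≤ g
    g≥0 = gram-diag-nonneg A zero
    g>0 : 0ℤ < g
    g>0 = ℤP.≤∧≢⇒< g≥0 (g≢0 ∘ sym)
    gᵏ>0 : 0ℤ < gᵏ
    gᵏ>0 = ^-pos k g>0
    reorder : ∀ g p q → g * (p * (p * q)) ≡ p * p * (g * q)
    reorder = solve-∀

  hadamard-01 : ∀ r (M : SMat r) → (∀ i j → M i j ≡ 0ℤ ⊎ M i j ≡ 1ℤ) →
    ℤ.∣ det M ∣ ℕ.* ℤ.∣ det M ∣ ℕ.≤ r ℕ.^ r
  hadamard-01 r M M01 = ℤP.drop‿+≤+ (begin
    + (ℤ.∣ det M ∣ ℕ.* ℤ.∣ det M ∣)   ≡⟨ square≡∣∣² (det M) ⟨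
    det M * det M                    ≡⟨ cong (det M *_) (det-ᵀ M) ⟨
    det M * det (M ᵀ)                ≡⟨ det-mul M (M ᵀ) ⟨
    det (gram M)                     ≤⟨ hadamard-gram r M ⟩
    ∏ (λ i → gram M i i)             ≤⟨ ∏-mono _ _ (gram-diag-nonneg M) (λ i → sum-≤-count _ (λ l → entry² (M01 i l))) ⟩
    ∏ {r} (λ _ → + r)                ≡⟨ trans (∏-const r (+ r)) (pos-^ r r) ⟩
    + (r ℕ.^ r)                      ∎)
    where
    open ℤP.≤-Reasoning
    entry² : ∀ {e} → e ≡ 0ℤ ⊎ e ≡ 1ℤ → e * e ≤ 1ℤ
    entry² (inj₁ refl) = +≤+ ℕ.z≤n
    entry² (inj₂ refl) = +≤+ (ℕ.s≤s ℕ.z≤n)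

-- It is found greedily by exhaustive search; r ≤ s because the
-- chosen functions are distinct.
module MaximalMinor (n s : ℕ) (cs : Fin s → Vec Bool n → Bool) where

  open import Data.Nat using (zero; suc; _+_; _≤_)
  import Data.Nat.Properties as ℕP
  open import Data.Bool using (true; false)
  open import Data.Vec using ([]; _∷_)
  open import Data.Fin using (zero; suc)
  import Data.Fin.Properties as FinP
  open import Data.Integer as ℤ using (ℤ; 0ℤ; 1ℤ)
  import Data.Integer.Properties as ℤP
  open import Data.Product using (Σ; ∃; _,_)
  open import Data.Sum using (_⊎_; inj₁; inj₂)
  open import Data.Empty using (⊥-elim)
  open import Relation.Nullary using (Dec; yes; no)
  open import Relation.Nullary.Decidable using (map′; _⊎-dec_; ¬?; decidable-stable)
  open import Relation.Binary.PropositionalEquality using (_≡_; _≢_; refl; cong; sym; trans)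
  open import Function using (_∘_)
  import Data.Vec.Functional as VF

  open Determinant ℤP.+-*-commutativeRing using (SMat; det; det-alt)

  bitℤ : Bool → ℤ
  bitℤ true  = 1ℤ
  bitℤ false = 0ℤ

  evalMatrix : ∀ {r} → (Fin r → Vec Bool n → Bool) → (Fin r → Vec Bool n) → SMat r
  evalMatrix fs xs j a = bitℤ (fs j (xs a))

  record Minor (r : ℕ) : Set where
    field
      points      : Fin r → Vec Bool n
      funcs       : Fin r → Fin s
      injective   : ∀ a b → funcs a ≡ funcs b → a ≡ b
      nonsingular : det (evalMatrix (cs ∘ funcs) points) ≢ 0ℤ
  open Minor

  bordered : ∀ {r} → Minor r → Vec Bool n → Fin s → SMat (suc r)
  bordered M x i = evalMatrix (cs ∘ (i VF.∷ funcs M)) (x VF.∷ points M)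

  Maximal : ∀ {r} → Minor r → Set
  Maximal M = ∀ x i → det (bordered M x i) ≡ 0ℤ

  minor-size : ∀ {r} → Minor r → r ≤ s
  minor-size M = FinP.injective⇒≤ (λ {a} {b} → injective M a b)

  any-input? : ∀ m {P : Vec Bool m → Set} → (∀ x → Dec (P x)) → Dec (∃ P)
  any-input? zero    P? = map′ (λ p → [] , p) (λ { ([] , p) → p }) (P? [])
  any-input? (suc m) P? = map′ to from (any-input? m (P? ∘ (true ∷_)) ⊎-dec any-input? m (P? ∘ (false ∷_)))
    where
    to = λ { (inj₁ (v , p)) → true ∷ v , p ; (inj₂ (v , p)) → false ∷ v , p }
    from = λ { (true ∷ v , p) → inj₁ (v , p) ; (false ∷ v , p) → inj₂ (v , p) }

  enlargeable? : ∀ {r} (M : Minor r) → (∃ λ x → ∃ λ i → det (bordered M x i) ≢ 0ℤ) ⊎ Maximal M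
  enlargeable? M with any-input? n (λ x → FinP.any? (λ i → ¬? (det (bordered M x i) ℤ.≟ 0ℤ)))
  ... | yes witness = inj₁ witness
  ... | no none     = inj₂ (λ x i → decidable-stable (det (bordered M x i) ℤ.≟ 0ℤ) (λ nz → none (x , i , nz)))

  -- a nonsingular bordered minor is again a minor; the new function is
  -- distinct from the old ones, else two rows would coincide
  enlarge : ∀ {r} (M : Minor r) x i → det (bordered M x i) ≢ 0ℤ → Minor (suc r)
  enlarge M x i nz = record
    { points = x VF.∷ points M ; funcs = i VF.∷ funcs M ; injective = injective′ ; nonsingular = nz }
    where
    fresh : ∀ b → i ≢ funcs M b
    fresh b i≡ = nz (det-alt zero (suc b) (λ ()) (bordered M x i)
                      (λ a → cong (λ t → bitℤ (cs t ((x VF.∷ points M) a))) i≡))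
    injective′ : ∀ a b → (i VF.∷ funcs M) a ≡ (i VF.∷ funcs M) b → a ≡ b
    injective′ zero    zero    _ = refl
    injective′ zero    (suc b) e = ⊥-elim (fresh b e)
    injective′ (suc a) zero    e = ⊥-elim (fresh a (sym e))
    injective′ (suc a) (suc b) e = cong suc (injective M a b e)

  empty : Minor 0
  empty = record { points = λ () ; funcs = λ () ; injective = λ () ; nonsingular = λ () }

  -- enlarge greedily; at most s steps are possible
  grow : ∀ fuel {r} → fuel + r ≡ s → Minor r → ∃ λ r′ → Σ (Minor r′) Maximal
  grow fuel       eq M with enlargeable? M
  grow fuel       eq M | inj₂ maximal         = _ , M , maximal
  grow zero       eq M | inj₁ (x , i , nz)    =
    ⊥-elim (ℕP.<-irrefl eq (minor-size (enlarge M x i nz)))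
  grow (suc fuel) eq M | inj₁ (x , i , nz)    =
    grow fuel (trans (ℕP.+-suc fuel _) eq) (enlarge M x i nz)

  maximal-minor : ∃ λ r → Σ (Minor r) Maximal
  maximal-minor = grow s (ℕP.+-identityʳ s) empty

module Reweighting {c ℓ} (F : CharZeroField c ℓ) (n s : ℕ)
  (α : Fin s → CharZeroField.Carrier F) (cs : Fin s → Vec Bool n → Bool)
  (boolean : BooleanValued F s α cs) where

  open import Data.Nat as ℕ using (zero; suc; _≤_; _^_)
  import Data.Nat.Properties as ℕP
  open import Data.Bool using (true; false)
  open import Data.Integer as ℤ using (ℤ; +_; -[1+_]; 0ℤ; 1ℤ)
  import Data.Integer.Properties as ℤP
  open import Data.Integer.Tactic.RingSolver using (solve-∀)
  open import Data.Fin using (zero; suc; punchIn)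
  open import Data.Product using (proj₁; proj₂)
  open import Data.Sum using (_⊎_; inj₁; inj₂)
  open import Data.Empty using (⊥-elim)
  open import Relation.Nullary using (¬_)
  import Relation.Binary.PropositionalEquality as ≡
  open ≡ using (_≡_)
  open import Function using (_∘_)
  import Data.Vec.Functional as VF

  open import Algebra.Bundles using (CommutativeRing)
  open CharZeroField F hiding (zero)
  import Relation.Binary.Reasoning.Setoid as SetoidReasoning
  module ≈-Reasoning = SetoidReasoning setoid
  open import Algebra.Properties.Ring (CommutativeRing.ring ring) using (-‿injective; -0#≈0#)
  open IntegerImage ring using (intᴿ; intᴿ-*)
  open DeterminantImage ring using (intᴿ-sum; intᴿ-det)
  module Dℤ = Determinant ℤP.+-*-commutativeRing
  module Dᴿ = Determinant ring
  open Hadamard using (hadamard-01)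
  open MaximalMinor n s cs using (bitℤ; evalMatrix; Minor; bordered; Maximal; maximal-minor; minor-size)

  intᴿ≈0⇒≡0 : ∀ z → intᴿ z ≈ 0# → z ≡ 0ℤ
  intᴿ≈0⇒≡0 (+ zero)    _ = ≡.refl
  intᴿ≈0⇒≡0 (+ suc k)   e = ⊥-elim (charZero k e)
  intᴿ≈0⇒≡0 -[1+ k ]    e = ⊥-elim (charZero k (-‿injective (trans e (sym -0#≈0#))))

  fromℤ≈intᴿ : ∀ z → fromℤ F z ≈ intᴿ z
  fromℤ≈intᴿ (+ k)    = refl
  fromℤ≈intᴿ -[1+ k ] = refl

  bit≈intᴿ : ∀ b → bit F b ≈ intᴿ (bitℤ b)
  bit≈intᴿ true  = sym (+-identityʳ 1#)
  bit≈intᴿ false = refl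

  sumF≈sum : ∀ {m} (f : Fin m → Carrier) → sumF F m f ≈ Dᴿ.sum f
  sumF≈sum {zero}  f = refl
  sumF≈sum {suc m} f = +-congˡ (sumF≈sum (f ∘ suc))

  output : Vec Bool n → Bool
  output x with boolean x
  ... | inj₁ _ = false
  ... | inj₂ _ = true

  output-correct : ∀ x → evalSum F s α cs x ≈ bit F (output x)
  output-correct x with boolean x
  ... | inj₁ ≈0 = ≈0
  ... | inj₂ ≈1 = ≈1

  r : ℕ
  r = proj₁ maximal-minor

  M : Minor r
  M = proj₁ (proj₂ maximal-minor)

  maximal : Maximal M
  maximal = proj₂ (proj₂ maximal-minor)

  R : Fin r → Vec Bool n
  R = Minor.points M

  S : Fin r → Fin s
  S = Minor.funcs M

  d : ℤ
  d = Dℤ.det (evalMatrix (cs ∘ S) R)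

  withOutput : Vec Bool n → Dℤ.SMat (suc r)
  withOutput x = evalMatrix (output VF.∷ (cs ∘ S)) (x VF.∷ R)

  -- cofactor of row j+1 in column 0 of withOutput x; independent of x
  cofactorMatrix : Fin r → Dℤ.SMat r
  cofactorMatrix j a b = bitℤ ((output VF.∷ (cs ∘ S)) (punchIn (suc j) a) (R b))

  w : Fin r → ℤ
  w j = Dℤ.sgn j ℤ.* Dℤ.det (cofactorMatrix j)

  -- Over F the output row is Σᵢ αᵢ (row of cᵢ), so by linearity in row 0
  -- det (withOutput x) = Σᵢ αᵢ det (bordered M x i) = 0; by characteristic
  -- zero it already vanishes over ℤ.
  withOutput-singular : ∀ x → Dℤ.det (withOutput x) ≡ 0ℤ
  withOutput-singular x = intᴿ≈0⇒≡0 _ (begin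
    intᴿ (Dℤ.det (withOutput x))                                ≈⟨ intᴿ-det (withOutput x) ⟩
    Dᴿ.det Wᴿ                                                   ≈⟨ D-expand zero α rowᴿ Wᴿ output-row ⟩
    Dᴿ.sum (λ i → α i * Dᴿ.det (Dᴿ.setRow Wᴿ zero (rowᴿ i)))    ≈⟨ Dᴿ.sum-cong (λ i → *-congˡ (bordered-vanishes i)) ⟩
    Dᴿ.sum (λ i → α i * 0#)                                     ≈⟨ Dᴿ.sum-zero (λ i → α i * 0#) (λ i → zeroʳ (α i)) ⟩
    0#                                                          ∎)
    where
    open ≈-Reasoning
    open Dᴿ.RowLinearForm Dᴿ.det Dᴿ.det-cong Dᴿ.det-lin using (D-expand)
    Wᴿ : Dᴿ.SMat (suc r)
    Wᴿ i j = intᴿ (withOutput x i j)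
    rowᴿ : Fin s → Fin (suc r) → Carrier
    rowᴿ i b = intᴿ (bordered M x i zero b)
    output-row : ∀ b → Wᴿ zero b ≈ Dᴿ.sum (λ i → α i * rowᴿ i b)
    output-row b = begin
      intᴿ (bitℤ (output y))                        ≈⟨ bit≈intᴿ (output y) ⟨
      bit F (output y)                              ≈⟨ output-correct y ⟨
      sumF F s (λ i → α i * bit F (cs i y))         ≈⟨ sumF≈sum (λ i → α i * bit F (cs i y)) ⟩
      Dᴿ.sum (λ i → α i * bit F (cs i y))           ≈⟨ Dᴿ.sum-cong (λ i → *-congˡ (bit≈intᴿ (cs i y))) ⟩
      Dᴿ.sum (λ i → α i * rowᴿ i b)                 ∎
      where y = (x VF.∷ R) b
    bordered-vanishes : ∀ i → Dᴿ.det (Dᴿ.setRow Wᴿ zero (rowᴿ i)) ≈ 0#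
    bordered-vanishes i = begin
      Dᴿ.det (Dᴿ.setRow Wᴿ zero (rowᴿ i))             ≈⟨ Dᴿ.det-cong rows ⟩
      Dᴿ.det (λ a b → intᴿ (bordered M x i a b))      ≈⟨ intᴿ-det (bordered M x i) ⟨
      intᴿ (Dℤ.det (bordered M x i))                  ≡⟨ ≡.cong intᴿ (maximal x i) ⟩
      0#                                              ∎
      where
      rows : Dᴿ.setRow Wᴿ zero (rowᴿ i) Dᴿ.≋ (λ a b → intᴿ (bordered M x i a b))
      rows zero    b = Dᴿ.setRow-≡ Wᴿ zero (rowᴿ i) b
      rows (suc a) b = Dᴿ.setRow-≢ Wᴿ zero (rowᴿ i) {suc a} (λ ()) b

  -- Cramer's rule: expanding det (withOutput x) = 0 along column 0.
  cramer : ∀ x → bitℤ (output x) ℤ.* d ≡ Dℤ.sum (λ j → w j ℤ.* bitℤ (cs (S j) x))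
  cramer x = begin
    b ℤ.* d                                              ≡⟨ isolate (b ℤ.* d) Σ′ ⟩
    (1ℤ ℤ.* (b ℤ.* d) ℤ.+ Σ′) ℤ.+ ℤ.- 1ℤ ℤ.* Σ′           ≡⟨ ≡.cong (λ t → t ℤ.+ ℤ.- 1ℤ ℤ.* Σ′) (withOutput-singular x) ⟩
    0ℤ ℤ.+ ℤ.- 1ℤ ℤ.* Σ′                                 ≡⟨ ℤP.+-identityˡ _ ⟩
    ℤ.- 1ℤ ℤ.* Σ′                                        ≡⟨ ≡.sym (*-distribˡ-sum (ℤ.- 1ℤ) term) ⟨
    Dℤ.sum (λ j → ℤ.- 1ℤ ℤ.* term j)                     ≡⟨ Dℤ.sum-cong (λ j → flip-sign (Dℤ.sgn j) (bitℤ (cs (S j) x)) (Dℤ.det (cofactorMatrix j))) ⟩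
    Dℤ.sum (λ j → w j ℤ.* bitℤ (cs (S j) x))             ∎
    where
    open ≡.≡-Reasoning
    open import Algebra.Properties.Semiring.Sum ℤP.+-*-semiring using (*-distribˡ-sum)
    b = bitℤ (output x)
    term = λ j → ℤ.- Dℤ.sgn j ℤ.* (bitℤ (cs (S j) x) ℤ.* Dℤ.det (cofactorMatrix j))
    Σ′ = Dℤ.sum term
    isolate : ∀ y t → y ≡ (1ℤ ℤ.* y ℤ.+ t) ℤ.+ ℤ.- 1ℤ ℤ.* t
    isolate = solve-∀
    flip-sign : ∀ σ c e → ℤ.- 1ℤ ℤ.* (ℤ.- σ ℤ.* (c ℤ.* e)) ≡ σ ℤ.* e ℤ.* c
    flip-sign = solve-∀

  d≢0 : ¬ (d ≡ 0ℤ)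
  d≢0 = Minor.nonsingular M

  d⁻¹ : Carrier
  d⁻¹ = proj₁ (inverse (intᴿ d) (d≢0 ∘ intᴿ≈0⇒≡0 d))

  d*d⁻¹≈1 : intᴿ d * d⁻¹ ≈ 1#
  d*d⁻¹≈1 = proj₂ (inverse (intᴿ d) (d≢0 ∘ intᴿ≈0⇒≡0 d))

  α′ : Fin r → Carrier
  α′ j = intᴿ (w j) * d⁻¹

  α′-ratio : ∀ j → α′ j * fromℤ F d ≈ fromℤ F (w j)
  α′-ratio j = begin
    intᴿ (w j) * d⁻¹ * fromℤ F d      ≈⟨ *-congˡ (fromℤ≈intᴿ d) ⟩
    intᴿ (w j) * d⁻¹ * intᴿ d         ≈⟨ *-assoc _ _ _ ⟩
    intᴿ (w j) * (d⁻¹ * intᴿ d)       ≈⟨ *-congˡ (trans (*-comm _ _) d*d⁻¹≈1) ⟩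
    intᴿ (w j) * 1#                   ≈⟨ *-identityʳ _ ⟩
    intᴿ (w j)                        ≈⟨ fromℤ≈intᴿ (w j) ⟨
    fromℤ F (w j)                     ∎
    where open ≈-Reasoning

  represents : ∀ x → evalSum F r α′ (cs ∘ S) x ≈ evalSum F s α cs x
  represents x = begin
    sumF F r (λ j → α′ j * bit F (cs (S j) x))                 ≈⟨ sumF≈sum (λ j → α′ j * bit F (cs (S j) x)) ⟩
    Dᴿ.sum (λ j → α′ j * bit F (cs (S j) x))                   ≈⟨ Dᴿ.sum-cong term ⟩
    Dᴿ.sum (λ j → d⁻¹ * intᴿ (w j ℤ.* bitℤ (cs (S j) x)))      ≈⟨ *-distribˡ-sum d⁻¹ (λ j → intᴿ (w j ℤ.* bitℤ (cs (S j) x))) ⟨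
    d⁻¹ * Dᴿ.sum (λ j → intᴿ (w j ℤ.* bitℤ (cs (S j) x)))      ≈⟨ *-congˡ (intᴿ-sum (λ j → w j ℤ.* bitℤ (cs (S j) x))) ⟨
    d⁻¹ * intᴿ (Dℤ.sum (λ j → w j ℤ.* bitℤ (cs (S j) x)))      ≡⟨ ≡.cong (λ t → d⁻¹ * intᴿ t) (cramer x) ⟨
    d⁻¹ * intᴿ (bitℤ (output x) ℤ.* d)                         ≈⟨ *-congˡ (intᴿ-* (bitℤ (output x)) d) ⟩
    d⁻¹ * (intᴿ (bitℤ (output x)) * intᴿ d)                    ≈⟨ trans (*-comm _ _) (*-assoc _ _ _) ⟩
    intᴿ (bitℤ (output x)) * (intᴿ d * d⁻¹)                    ≈⟨ trans (*-congˡ d*d⁻¹≈1) (*-identityʳ _) ⟩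
    intᴿ (bitℤ (output x))                                     ≈⟨ bit≈intᴿ (output x) ⟨
    bit F (output x)                                           ≈⟨ output-correct x ⟨
    evalSum F s α cs x                                         ∎
    where
    open ≈-Reasoning
    open import Algebra.Properties.Semiring.Sum semiring using (*-distribˡ-sum)
    term : ∀ j → α′ j * bit F (cs (S j) x) ≈ d⁻¹ * intᴿ (w j ℤ.* bitℤ (cs (S j) x))
    term j = begin
      intᴿ (w j) * d⁻¹ * bit F (cs (S j) x)               ≈⟨ *-congˡ (bit≈intᴿ (cs (S j) x)) ⟩
      intᴿ (w j) * d⁻¹ * intᴿ (bitℤ (cs (S j) x))         ≈⟨ trans (*-congʳ (*-comm _ _)) (*-assoc _ _ _) ⟩
      d⁻¹ * (intᴿ (w j) * intᴿ (bitℤ (cs (S j) x)))       ≈⟨ *-congˡ (intᴿ-* (w j) (bitℤ (cs (S j) x))) ⟨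
      d⁻¹ * intᴿ (w j ℤ.* bitℤ (cs (S j) x))              ∎

  -- Size bounds: d and wⱼ are (up to sign) determinants of r × r 0/1
  -- matrices, and r ≤ s.

  ^-self-mono : ∀ {a b} → a ≤ b → a ^ a ≤ b ^ b
  ^-self-mono {zero}  {zero}  _   = ℕP.≤-refl
  ^-self-mono {zero}  {suc b} _   = ℕP.m^n>0 (suc b) (suc b)
  ^-self-mono {suc a} {suc b} a≤b = ℕP.≤-trans (ℕP.^-monoˡ-≤ (suc a) a≤b) (ℕP.^-monoʳ-≤ (suc b) a≤b)

  bit-01 : ∀ b → bitℤ b ≡ 0ℤ ⊎ bitℤ b ≡ 1ℤ
  bit-01 true  = inj₂ ≡.refl
  bit-01 false = inj₁ ≡.refl

  boolean-det-bound : ∀ (B : Dℤ.SMat r) → (∀ i j → B i j ≡ 0ℤ ⊎ B i j ≡ 1ℤ) →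
    ℤ.∣ Dℤ.det B ∣ ℕ.* ℤ.∣ Dℤ.det B ∣ ≤ s ^ s
  boolean-det-bound B B01 = ℕP.≤-trans (hadamard-01 r B B01) (^-self-mono (minor-size M))

  d-bound : ℤ.∣ d ∣ ℕ.* ℤ.∣ d ∣ ≤ s ^ s
  d-bound = boolean-det-bound _ (λ _ _ → bit-01 _)

  ∣sgn∣≡1 : ∀ {m} (j : Fin m) → ℤ.∣ Dℤ.sgn j ∣ ≡ 1
  ∣sgn∣≡1 zero    = ≡.refl
  ∣sgn∣≡1 (suc j) = ≡.trans (ℤP.∣-i∣≡∣i∣ (Dℤ.sgn j)) (∣sgn∣≡1 j)

  w-bound : ∀ j → ℤ.∣ w j ∣ ℕ.* ℤ.∣ w j ∣ ≤ s ^ s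
  w-bound j = ≡.subst (λ t → t ℕ.* t ≤ s ^ s) (≡.sym ∣w∣≡∣cof∣) (boolean-det-bound _ (λ _ _ → bit-01 _))
    where
    cof = Dℤ.det (cofactorMatrix j)
    ∣w∣≡∣cof∣ : ℤ.∣ w j ∣ ≡ ℤ.∣ cof ∣
    ∣w∣≡∣cof∣ = ≡.trans (ℤP.abs-* (Dℤ.sgn j) cof) (≡.trans (≡.cong (ℕ._* ℤ.∣ cof ∣) (∣sgn∣≡1 j)) (ℕP.*-identityˡ ℤ.∣ cof ∣))

open import Data.Nat using (ℕ; _≤_; _^_; _*_)
open import Data.Integer using (ℤ; ∣_∣; +_)
open import Data.Product using (Σ; _×_; _,_)
open import Relation.Nullary using (¬_)
open import Relation.Binary.PropositionalEquality using (_≡_)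
open import Function using (_∘_)

-- The new circuit keeps the r functions cs ∘ S of the maximal minor; the
-- weight of cs (S j) is wⱼ / d with d the determinant of the minor.
proposition2p1 : ∀ {c ℓ p} (F : CharZeroField c ℓ) (n : ℕ)
    (𝒞 : (Vec Bool n → Bool) → Set p)
    (s : ℕ) (α : Fin s → CharZeroField.Carrier F) (cs : Fin s → Vec Bool n → Bool) →
    (∀ i → 𝒞 (cs i)) →
    BooleanValued F s α cs →
    Σ ℕ λ s′ → Σ (Fin s′ → CharZeroField.Carrier F) λ α′ → Σ (Fin s′ → Vec Bool n → Bool) λ cs′ →
      (∀ i → 𝒞 (cs′ i)) ×
      (∀ (x : Vec Bool n) → CharZeroField._≈_ F (evalSum F s′ α′ cs′ x) (evalSum F s α cs x)) ×
      (∀ i → Σ ℤ λ j → Σ ℤ λ k →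
        (∣ j ∣ * ∣ j ∣ ≤ s ^ s) × (∣ k ∣ * ∣ k ∣ ≤ s ^ s) × ¬ (k ≡ + 0) ×
        CharZeroField._≈_ F (CharZeroField._*_ F (α′ i) (fromℤ F k)) (fromℤ F j))
proposition2p1 F n 𝒞 s α cs in-𝒞 boolean =
  r , α′ , cs ∘ S , (λ j → in-𝒞 (S j)) , represents ,
  (λ j → w j , d , w-bound j , d-bound , d≢0 , α′-ratio j)
  where open Reweighting F n s α cs boolean
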